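{- For any graph $G$ and any core $X$ of $G$, every component of $G-X$ has at most two edges to $X$. Moreover, if $G$ is connected and has at least two cores, then for any vertex $x$ of $G$ there exists a core $X\subseteq V(G)\setminus\{x\}$ such that $G-X$ is connected.
   Context: Graphs are finite, undirected, with parallel edges and loops allowed. A core of a graph $G$ is a maximal set of vertices of $G$ whose pairwise edge-connectivity is at least $3$ (i.e. any two distinct vertices in it are joined by at least three pairwise edge-disjoint paths). The cores of $G$ are pairwise disjoint and their union is $V(G)$. -}

module Defs where

open import Data.Nat using (ℕ; _≤_; _≥_)
open import Data.Fin using (Fin)
open import Data.Fin.Subset using (Subset; _∈_; _∉_; _⊆_)
open import Data.Fin.Subset.Properties using (_∈?_)
open import Data.List using (List; []; _∷_; length; filter; allFin)
open import Data.List.Relation.Unary.Unique.Propositional using (Unique)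
import Data.List.Membership.Propositional as LM
open import Data.Product using (_×_; _,_; proj₁; proj₂; Σ; ∃; ∃-syntax)
open import Data.Sum using (_⊎_)
open import Data.Empty using (⊥)
open import Relation.Nullary using (¬_)
open import Relation.Nullary.Decidable using (_×-dec_; _⊎-dec_)
open import Relation.Binary.PropositionalEquality using (_≡_)

-- A finite multigraph (parallel edges and loops allowed):
-- vertices Fin n, edges Fin m, each edge has an (unordered) pair of ends.
record Graph : Set where
  field
    n    : ℕ
    m    : ℕ
    ends : Fin m → Fin n × Fin n

module _ (G : Graph) where
  open Graph G

  V : Set
  V = Fin n

  E : Set
  E = Fin m

  Joins : E → V → V → Set
  Joins e u w = ends e ≡ (u , w) ⊎ ends e ≡ (w , u)

  data Walk : V → V → Set where
    nil  : ∀ {u} → Walk u u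
    cons : ∀ {u w v} (e : E) → Joins e u w → Walk w v → Walk u v

  walkEdges : ∀ {u v} → Walk u v → List E
  walkEdges nil          = []
  walkEdges (cons e _ p) = e ∷ walkEdges p

  walkVerts : ∀ {u v} → Walk u v → List V
  walkVerts {u} nil          = u ∷ []
  walkVerts {u} (cons _ _ p) = u ∷ walkVerts p

  IsPath : ∀ {u v} → Walk u v → Set
  IsPath p = Unique (walkVerts p)

  EdgeDisjoint : ∀ {u v u' v'} → Walk u v → Walk u' v' → Set
  EdgeDisjoint p q = ∀ e → e LM.∈ walkEdges p → e LM.∈ walkEdges q → ⊥

  ThreeEdgeConnected : V → V → Set
  ThreeEdgeConnected u v =
    Σ (Walk u v) λ p → Σ (Walk u v) λ q → Σ (Walk u v) λ r →
      IsPath p × IsPath q × IsPath r ×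
      EdgeDisjoint p q × EdgeDisjoint p r × EdgeDisjoint q r

  Cohesive : Subset n → Set
  Cohesive X = ∀ u v → u ∈ X → v ∈ X → ¬ (u ≡ v) → ThreeEdgeConnected u v

  IsCore : Subset n → Set
  IsCore X = Cohesive X × (∀ Y → X ⊆ Y → Cohesive Y → Y ⊆ X)

  Avoids : ∀ {u v} → Subset n → Walk u v → Set
  Avoids X p = ∀ w → w LM.∈ walkVerts p → w ∉ X

  ConnectedIn- : Subset n → V → V → Set
  ConnectedIn- X u v = Σ (Walk u v) λ p → Avoids X p

  Connected : Set
  Connected = ∀ (u v : V) → Walk u v

  ConnectedMinus : Subset n → Set
  ConnectedMinus X = ∀ u v → u ∉ X → v ∉ X → ConnectedIn- X u v

  IsComponentMinus : Subset n → Subset n → Set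
  IsComponentMinus X C =
    (∃[ c ] c ∈ C) ×
    (∀ u → u ∈ C → u ∉ X) ×
    (∀ u v → u ∈ C → v ∈ C → ConnectedIn- X u v) ×
    (∀ u v → u ∈ C → ConnectedIn- X u v → v ∈ C)

  edgesBetween : Subset n → Subset n → ℕ
  edgesBetween C X = length (filter cross? (allFin m))
    where
      cross? : ∀ e → _
      cross? e = ((proj₁ (ends e) ∈? C) ×-dec (proj₂ (ends e) ∈? X))
                 ⊎-dec ((proj₁ (ends e) ∈? X) ×-dec (proj₂ (ends e) ∈? C))

-- Write ∂ P for the number of edges with exactly one end in the vertex set P, and call u and v
-- linked if ∂ P ≥ 3 whenever u ∈ P and v ∉ P.  By the edge form of Menger's theorem (augment a
-- unit-capacity flow three times, then peel off three edge-disjoint paths against it) linked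
-- vertices are 3-edge-connected.  So being linked is an equivalence relation whose classes are
-- exactly the cores.
--
-- Let D be a component of G - X for a core X.  Each vertex of D is separated from some vertex of X
-- by a cut of at most two edges, which can be shrunk into D.  If ∂ D ≥ 3, take a maximal connected
-- such cut S ⊊ D and a minimal one T around a neighbour of S in D; submodularity and
-- posimodularity of ∂ force ∂ (S ∪ T) ≤ 2, against the maximality of S.  As every edge from D to X
-- leaves D, there are at most two of them.
--
-- For the second claim take a core K avoiding x.  If G - K is disconnected, some vertex z lies in
-- a component D of G - K other than the component R of x.  Since ∂ D ≤ 2 the core of z lies
-- inside D, and removing it instead of K leaves x in a component strictly larger than R; this
-- can only happen finitely often.

module Submission where

open import Defs
open import Data.Nat using (_≤_)
open import Data.Fin.Subset using (_∈_; _∉_)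
open import Data.Product using (_×_; ∃-syntax)
open import Relation.Nullary using (¬_)
open import Relation.Binary.PropositionalEquality using (_≡_)

open import Algebra.Bundles using (CommutativeMonoid)
import Algebra.Properties.Semiring.Sum
open import Data.Bool.Base using (Bool; true; false; _∧_; _∨_; not; _xor_; T; if_then_else_)
import Data.Bool.Properties as Bool
open import Data.Empty using (⊥; ⊥-elim)
open import Data.Fin.Base using (Fin; zero; suc; punchIn)
open import Data.Fin.Properties using (punchInᵢ≢i; any?; _≟_)
open import Data.Fin.Subset using (Subset; _⊆_; _⊂_; _⊃_; _∩_; _∪_; _─_; ∁; ⁅_⁆; Empty; Nonempty)
open import Data.Fin.Subset.Induction using (⊂-wellFounded; ⊃-wellFounded)
open import Data.Fin.Subset.Properties
  using (_∈?_; _⊆?_; nonempty?; anySubset?; ⊆-antisym; x∈⁅x⁆; x∈⁅y⁆⇒x≡y;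
         x∉p⇒x∈∁p; x∈∁p⇒x∉p; x∈p⇒x∉∁p; p⊆p∪q; q⊆p∪q; x∈p∪q⁻; p∩q⊆p; p∩q⊆q;
         x∈p∩q⁺; x∈p∩q⁻; p─q⊆p; x∈p∧x∉q⇒x∈p─q; p∩q≢∅⇒p─q⊂p)
open import Data.Integer.Base as ℤ using (ℤ)
import Data.Integer.Properties as ℤ
open import Data.Integer.Tactic.RingSolver using (solve-∀)
open import Data.List.Base as List using (List; length; filter)
open import Data.List.Membership.Propositional using () renaming (_∈_ to _∈ₗ_)
open import Data.List.Relation.Unary.Any using (here; there)
import Data.List.Relation.Unary.All as All
open import Data.List.Relation.Unary.AllPairs using ([]; _∷_)
open import Data.List.Relation.Unary.Unique.Propositional using (Unique)
open import Data.Maybe.Base using (Maybe; just; nothing)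
import Data.Maybe.Properties as Maybe
open import Data.Nat.Base using (ℕ; zero; suc; _+_; _*_; _<_; z≤n; s≤s)
import Data.Nat.Properties as ℕ
open import Data.Product.Base as Product using (Σ; _,_; proj₁; proj₂; ∃)
open import Data.Sum.Base as Sum using (_⊎_; inj₁; inj₂; [_,_]′)
open import Data.Vec.Base using (Vec; []; _∷_; lookup; tabulate)
open import Data.Vec.Properties using (lookup∘tabulate; lookup-zipWith; lookup-map; lookup⇒[]=; []=⇒lookup)
open import Data.Vec.Functional using (Vector; replicate; updateAt)
open import Data.Vec.Functional.Properties using (updateAt-updates; updateAt-minimal)
import Data.Vec.Relation.Unary.All as VecAll
open VecAll using ([]; _∷_)
open import Data.Vec.Relation.Unary.AllPairs as VecAllPairs using ([]; _∷_)
open import Function.Base using (_∘_; id; const; case_of_)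
open import Function.Bundles using (Equivalence)
open import Induction.WellFounded using (WellFounded; Acc; acc)
open import Relation.Binary.Construct.Closure.ReflexiveTransitive as Star using (Star; ε; _◅_; _◅◅_)
open import Relation.Binary.Core using (Rel)
open import Relation.Binary.Definitions using (DecidableEquality)
open import Relation.Binary.PropositionalEquality
  using (_≢_; refl; sym; trans; cong; cong₂; subst; subst₂; module ≡-Reasoning)
open import Relation.Nullary.Decidable
  using (Dec; yes; no; does; isYes; toWitness; dec-true; dec-false; ¬?; _→-dec_; _×-dec_; _⊎-dec_)
import Relation.Nullary.Decidable as Dec
open import Relation.Nullary.Negation using (contradiction)
open import Relation.Unary using (Pred; Decidable)

𝟙 : Bool → ℕ
𝟙 true  = 1
𝟙 false = 0

∀-Bool : (Bool → Bool) → Bool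
∀-Bool f = f true ∧ f false

∀-Bool-sound : ∀ f → T (∀-Bool f) → ∀ b → T (f b)
∀-Bool-sound f ok true  = proj₁ (Equivalence.to Bool.T-∧ ok)
∀-Bool-sound f ok false = proj₂ (Equivalence.to Bool.T-∧ ok)

-- For a closed P the second argument evaluates to ⊤, so callers pass _.
decide⁴ : {P : Bool → Bool → Bool → Bool → Set} (P? : ∀ a b c d → Dec (P a b c d)) →
          T (∀-Bool λ a → ∀-Bool λ b → ∀-Bool λ c → ∀-Bool λ d → isYes (P? a b c d)) →
          ∀ a b c d → P a b c d
decide⁴ P? ok a b c d =
  toWitness {a? = P? a b c d} (∀-Bool-sound (isYes ∘ P? a b c) (∀-Bool-sound (λ c → ∀-Bool (isYes ∘ P? a b c))
    (∀-Bool-sound (λ b → ∀-Bool λ c → ∀-Bool (isYes ∘ P? a b c))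
      (∀-Bool-sound (λ a → ∀-Bool λ b → ∀-Bool λ c → ∀-Bool (isYes ∘ P? a b c)) ok a) b) c) d)

xor-submodular : ∀ a b c d →
  𝟙 ((a ∧ c) xor (b ∧ d)) + 𝟙 ((a ∨ c) xor (b ∨ d)) ≤ 𝟙 (a xor b) + 𝟙 (c xor d)
xor-submodular = decide⁴ (λ _ _ _ _ → _ ℕ.≤? _) _

xor-posimodular : ∀ a b c d →
  𝟙 ((a ∧ not c) xor (b ∧ not d)) + 𝟙 ((c ∧ not a) xor (d ∧ not b)) ≤ 𝟙 (a xor b) + 𝟙 (c xor d)
xor-posimodular = decide⁴ (λ _ _ _ _ → _ ℕ.≤? _) _

xor-split : ∀ a b c d →
  𝟙 (a xor b) + 2 * 𝟙 (((a ∧ c) ∧ (b ∧ not d)) ∨ ((a ∧ not c) ∧ (b ∧ d))) ≡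
  𝟙 ((a ∧ c) xor (b ∧ d)) + 𝟙 ((a ∧ not c) xor (b ∧ not d))
xor-split = decide⁴ (λ _ _ _ _ → _ ℕ.≟ _) _

xor-disjoint-∨ : ∀ a b c d → a ∧ c ≡ false → b ∧ d ≡ false →
  𝟙 ((a ∨ c) xor (b ∨ d)) + 2 * 𝟙 ((a ∧ d) ∨ (c ∧ b)) ≡ 𝟙 (a xor b) + 𝟙 (c xor d)
xor-disjoint-∨ = decide⁴ (λ _ _ _ _ → (_ Bool.≟ _) →-dec (_ Bool.≟ _) →-dec (_ ℕ.≟ _)) _

xor-bounds-between : ∀ a b c d → a ∧ c ≡ false → b ∧ d ≡ false →
  𝟙 ((a ∧ d) ∨ (c ∧ b)) ≤ 𝟙 (a xor b)
xor-bounds-between = decide⁴ (λ _ _ _ _ → (_ Bool.≟ _) →-dec (_ Bool.≟ _) →-dec (_ ℕ.≤? _)) _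

module _ {c ℓ} (M : CommutativeMonoid c ℓ) where
  open CommutativeMonoid M renaming (_∙_ to _+ᴹ_; ε to 0ᴹ)
  open import Algebra.Properties.CommutativeMonoid.Sum M using (sum; sum-remove; sum-cong-≋; sum-replicate-zero)
  open import Relation.Binary.Reasoning.Setoid setoid

  sum-pointed : ∀ {n} (t : Vector Carrier n) i → (∀ j → j ≢ i → t j ≈ 0ᴹ) → sum t ≈ t i
  sum-pointed {suc n} t i vanishes = begin
    sum t                        ≈⟨ sum-remove {i = i} t ⟩
    t i +ᴹ sum (t ∘ punchIn i)
      ≈⟨ ∙-congˡ (sum-cong-≋ λ j → vanishes (punchIn i j) (punchInᵢ≢i i j)) ⟩
    t i +ᴹ sum (replicate n 0ᴹ)  ≈⟨ ∙-congˡ (sum-replicate-zero n) ⟩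
    t i +ᴹ 0ᴹ                    ≈⟨ identityʳ (t i) ⟩
    t i                          ∎

module ℕ-Sum = Algebra.Properties.Semiring.Sum ℕ.+-*-semiring
open ℕ-Sum using (sum; sum-cong-≗)

sum-mono-≤ : ∀ {k} {f g : Fin k → ℕ} → (∀ i → f i ≤ g i) → sum f ≤ sum g
sum-mono-≤ {zero}  f≤g = z≤n
sum-mono-≤ {suc k} f≤g = ℕ.+-mono-≤ (f≤g zero) (sum-mono-≤ (f≤g ∘ suc))

sum-pair-≤ : ∀ {k} {f g f′ g′ : Fin k → ℕ} → (∀ i → f i + g i ≤ f′ i + g′ i) →
             sum f + sum g ≤ sum f′ + sum g′
sum-pair-≤ {f = f} {g} {f′} {g′} le = begin
  sum f + sum g        ≡⟨ ℕ-Sum.∑-distrib-+ f g ⟨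
  sum (λ i → f i + g i)      ≤⟨ sum-mono-≤ le ⟩
  sum (λ i → f′ i + g′ i)    ≡⟨ ℕ-Sum.∑-distrib-+ f′ g′ ⟩
  sum f′ + sum g′      ∎
  where open ℕ.≤-Reasoning

sum-pair-≡ : ∀ {k} {f g f′ g′ : Fin k → ℕ} → (∀ i → f i + g i ≡ f′ i + g′ i) →
             sum f + sum g ≡ sum f′ + sum g′
sum-pair-≡ {f = f} {g} {f′} {g′} eq = begin
  sum f + sum g        ≡⟨ ℕ-Sum.∑-distrib-+ f g ⟨
  sum (λ i → f i + g i)      ≡⟨ sum-cong-≗ eq ⟩
  sum (λ i → f′ i + g′ i)    ≡⟨ ℕ-Sum.∑-distrib-+ f′ g′ ⟩
  sum f′ + sum g′      ∎
  where open ≡-Reasoning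

term≤sum : ∀ {k} (f : Fin k → ℕ) i → f i ≤ sum f
term≤sum {suc k} f i = ℕ.≤-trans (ℕ.m≤m+n (f i) _) (ℕ.≤-reflexive (sym (ℕ-Sum.sum-remove {i = i} f)))

three≤sum : ∀ {k} (f : Fin k → ℕ) {i j l} → i ≢ j → i ≢ l → j ≢ l →
            1 ≤ f i → 1 ≤ f j → 1 ≤ f l → 3 ≤ sum f
three≤sum f {i} {j} {l} i≢j i≢l j≢l fi fj fl = begin
  3
    ≡⟨ cong₂ _+_ (cong₂ _+_ (sum-point i) (sum-point j)) (sum-point l) ⟨
  sum (point i) + sum (point j) + sum (point l)
    ≡⟨ cong (_+ sum (point l)) (ℕ-Sum.∑-distrib-+ (point i) (point j)) ⟨
  sum (λ x → point i x + point j x) + sum (point l)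
    ≡⟨ ℕ-Sum.∑-distrib-+ (λ x → point i x + point j x) (point l) ⟨
  sum (λ x → point i x + point j x + point l x)
    ≤⟨ sum-mono-≤ bounded ⟩
  sum f ∎
  where
  open ℕ.≤-Reasoning
  point : Fin _ → Fin _ → ℕ
  point a x = 𝟙 (does (a ≟ x))
  sum-point : ∀ a → sum (point a) ≡ 1
  sum-point a = trans (sum-pointed ℕ.+-0-commutativeMonoid (point a) a
                        (λ x x≢a → cong 𝟙 (dec-false (a ≟ x) (x≢a ∘ sym))))
                      (cong 𝟙 (dec-true (a ≟ a) refl))
  bounded : ∀ x → point i x + point j x + point l x ≤ f x
  bounded x with i ≟ x | j ≟ x | l ≟ x
  ... | yes refl | yes refl | _        = contradiction refl i≢j
  ... | yes refl | no _     | yes refl = contradiction refl i≢l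
  ... | no _     | yes refl | yes refl = contradiction refl j≢l
  ... | yes refl | no _     | no _     = fi
  ... | no _     | yes refl | no _     = fj
  ... | no _     | no _     | yes refl = fl
  ... | no _     | no _     | no _     = z≤n

length-filter-tabulate : ∀ {a p} {A : Set a} {P : Pred A p} (P? : Decidable P) {k} (f : Fin k → A) →
                         length (filter P? (List.tabulate f)) ≡ sum (𝟙 ∘ does ∘ P? ∘ f)
length-filter-tabulate P? {zero}  f = refl
length-filter-tabulate P? {suc k} f with does (P? (f zero))
... | true  = cong suc (length-filter-tabulate P? (f ∘ suc))
... | false = length-filter-tabulate P? (f ∘ suc)

module ℤ-Sum = Algebra.Properties.Semiring.Sum ℤ.+-*-semiring

pos-sum : ∀ {k} (g : Fin k → ℕ) → ℤ-Sum.sum (λ i → ℤ.+ g i) ≡ ℤ.+ sum g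
pos-sum {zero}  g = refl
pos-sum {suc k} g = cong (ℤ._+_ (ℤ.+ g zero)) (pos-sum (g ∘ suc))

sum-update : ∀ {k} (g g′ : Fin k → ℤ) i → (∀ j → j ≢ i → g′ j ≡ g j) →
             ℤ-Sum.sum g′ ≡ ℤ-Sum.sum g ℤ.+ (g′ i ℤ.- g i)
sum-update {suc k} g g′ i agree = begin
  ℤ-Sum.sum g′
    ≡⟨ ℤ-Sum.sum-remove {i = i} g′ ⟩
  g′ i ℤ.+ ℤ-Sum.sum (g′ ∘ punchIn i)
    ≡⟨ cong (ℤ._+_ (g′ i)) (ℤ-Sum.sum-cong-≗ λ j → agree (punchIn i j) (punchInᵢ≢i i j)) ⟩
  g′ i ℤ.+ ℤ-Sum.sum (g ∘ punchIn i)
    ≡⟨ shift (g i) (g′ i) _ ⟩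
  (g i ℤ.+ ℤ-Sum.sum (g ∘ punchIn i)) ℤ.+ (g′ i ℤ.- g i)
    ≡⟨ cong (λ x → x ℤ.+ (g′ i ℤ.- g i)) (ℤ-Sum.sum-remove {i = i} g) ⟨
  ℤ-Sum.sum g ℤ.+ (g′ i ℤ.- g i) ∎
  where
  open ≡-Reasoning
  shift : ∀ a a′ r → a′ ℤ.+ r ≡ (a ℤ.+ r) ℤ.+ (a′ ℤ.- a)
  shift = solve-∀

∑-distrib-− : ∀ {k} (f g : Fin k → ℤ) →
              ℤ-Sum.sum (λ i → f i ℤ.- g i) ≡ ℤ-Sum.sum f ℤ.- ℤ-Sum.sum g
∑-distrib-− {zero}  f g = refl
∑-distrib-− {suc k} f g =
  trans (cong (ℤ._+_ (f zero ℤ.- g zero)) (∑-distrib-− (f ∘ suc) (g ∘ suc)))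
        (regroup (f zero) (g zero) (ℤ-Sum.sum (f ∘ suc)) (ℤ-Sum.sum (g ∘ suc)))
  where
  regroup : ∀ a b c d → (a ℤ.- b) ℤ.+ (c ℤ.- d) ≡ (a ℤ.+ c) ℤ.- (b ℤ.+ d)
  regroup = solve-∀

lookup-∩ : ∀ {n} (P Q : Subset n) v → lookup (P ∩ Q) v ≡ lookup P v ∧ lookup Q v
lookup-∩ P Q v = lookup-zipWith _∧_ v P Q

lookup-∪ : ∀ {n} (P Q : Subset n) v → lookup (P ∪ Q) v ≡ lookup P v ∨ lookup Q v
lookup-∪ P Q v = lookup-zipWith _∨_ v P Q

lookup-─ : ∀ {n} (P Q : Subset n) v → lookup (P ─ Q) v ≡ lookup P v ∧ not (lookup Q v)
lookup-─ (x ∷ P) (true  ∷ Q) zero    = sym (Bool.∧-zeroʳ x)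
lookup-─ (x ∷ P) (false ∷ Q) zero    = sym (Bool.∧-identityʳ x)
lookup-─ (_ ∷ P) (_ ∷ Q)     (suc v) = lookup-─ P Q v

lookup-∁ : ∀ {n} (P : Subset n) v → lookup (∁ P) v ≡ not (lookup P v)
lookup-∁ P v = lookup-map v not P

∉⇒lookup : ∀ {n} {P : Subset n} {v} → v ∉ P → lookup P v ≡ false
∉⇒lookup {P = P} {v} v∉P with lookup P v in eq
... | true  = contradiction (lookup⇒[]= v P eq) v∉P
... | false = refl

does-∈? : ∀ {n} v (P : Subset n) → does (v ∈? P) ≡ lookup P v
does-∈? zero    (true  ∷ P) = refl
does-∈? zero    (false ∷ P) = refl
does-∈? (suc v) (_ ∷ P)     = does-∈? v P

x∈p─q⁻ : ∀ {n} {x} (P Q : Subset n) → x ∈ P ─ Q → x ∈ P × x ∉ Q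
x∈p─q⁻ {x = x} P Q x∈P─Q = p─q⊆p P Q x∈P─Q , x∉Q
  where
  x∉Q : x ∉ Q
  x∉Q x∈Q with trans (sym ([]=⇒lookup x∈P─Q)) (lookup-─ P Q x)
  ... | eq rewrite []=⇒lookup x∈Q | Bool.∧-zeroʳ (lookup P x) with eq
  ... | ()

─-empty⇒⊆ : ∀ {n} {P Q : Subset n} → ¬ Nonempty (P ─ Q) → P ⊆ Q
─-empty⇒⊆ {Q = Q} P─Q=∅ {y} y∈P with y ∈? Q
... | yes y∈Q = y∈Q
... | no  y∉Q = contradiction (y , x∈p∧x∉q⇒x∈p─q y∈P y∉Q) P─Q=∅

_⊂?_ : ∀ {n} (P Q : Subset n) → Dec (P ⊂ Q)
P ⊂? Q = P ⊆? Q ×-dec any? λ x → x ∈? Q ×-dec ¬? (x ∈? P)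

extremal : ∀ {a r ℓ} {A : Set a} {_≺_ : Rel A r} {P : Pred A ℓ} → WellFounded _≺_ →
           (∀ x → Dec (∃[ y ] y ≺ x × P y)) → ∀ {x} → P x → ∃[ y ] P y × (∀ z → z ≺ y → ¬ P z)
extremal {_≺_ = _≺_} {P} wf smaller? {x} px = descend x (wf x) px
  where
  descend : ∀ x → Acc _≺_ x → P x → ∃[ y ] P y × (∀ z → z ≺ y → ¬ P z)
  descend x (acc rs) px with smaller? x
  ... | yes (y , y≺x , py) = descend y (rs y≺x) py
  ... | no  none           = x , px , λ z z≺x pz → none (z , z≺x , pz)

⊂-minimal : ∀ {n ℓ} {P : Pred (Subset n) ℓ} → Decidable P →
            ∀ {S} → P S → ∃[ T ] P T × (∀ U → U ⊂ T → ¬ P U)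
⊂-minimal P? = extremal ⊂-wellFounded (λ T → anySubset? λ U → U ⊂? T ×-dec P? U)

⊂-maximal : ∀ {n ℓ} {P : Pred (Subset n) ℓ} → Decidable P →
            ∀ {S} → P S → ∃[ T ] P T × (∀ U → T ⊂ U → ¬ P U)
⊂-maximal P? = extremal ⊃-wellFounded (λ T → anySubset? λ U → T ⊂? U ×-dec P? U)

≤-cancel-summand : ∀ {a b c d} → a + b ≤ c + d → d ≤ b → a ≤ c
≤-cancel-summand {a} {b} {c} {d} a+b≤c+d d≤b =
  ℕ.+-cancelʳ-≤ d a c (ℕ.≤-trans (ℕ.+-monoʳ-≤ a d≤b) a+b≤c+d)

module _ (G : Graph) where
  open Graph G
  open import Data.List.Membership.DecPropositional (_≟_ {m}) using () renaming (_∈?_ to _∈ₗ?_)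

  src tgt : E G → V G
  src e = proj₁ (ends e)
  tgt e = proj₂ (ends e)

  crossing : Subset n → E G → ℕ
  crossing P e = 𝟙 (lookup P (src e) xor lookup P (tgt e))

  ∂ : Subset n → ℕ
  ∂ P = sum (crossing P)

  Adjacent : Subset n → Subset n → Set
  Adjacent P Q = ∃[ e ] ((src e ∈ P × tgt e ∈ Q) ⊎ (src e ∈ Q × tgt e ∈ P))

  between : Subset n → Subset n → E G → ℕ
  between P Q e = 𝟙 ((lookup P (src e) ∧ lookup Q (tgt e)) ∨ (lookup Q (src e) ∧ lookup P (tgt e)))

  edgesBetween-sum : ∀ P Q → edgesBetween G P Q ≡ sum (between P Q)
  edgesBetween-sum P Q = begin
    edgesBetween G P Q
      ≡⟨ length-filter-tabulate
           (λ e → ((src e ∈? P) ×-dec (tgt e ∈? Q)) ⊎-dec ((src e ∈? Q) ×-dec (tgt e ∈? P))) id ⟩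
    sum (λ e → 𝟙 ((does (src e ∈? P) ∧ does (tgt e ∈? Q)) ∨ (does (src e ∈? Q) ∧ does (tgt e ∈? P))))
      ≡⟨ sum-cong-≗ (λ e → cong 𝟙 (cong₂ _∨_ (cong₂ _∧_ (does-∈? (src e) P) (does-∈? (tgt e) Q))
                                            (cong₂ _∧_ (does-∈? (src e) Q) (does-∈? (tgt e) P)))) ⟩
    sum (between P Q) ∎
    where open ≡-Reasoning

  ∂-∁ : ∀ P → ∂ (∁ P) ≡ ∂ P
  ∂-∁ P = sum-cong-≗ λ e → cong 𝟙 (begin
    lookup (∁ P) (src e) xor lookup (∁ P) (tgt e)
      ≡⟨ cong₂ _xor_ (lookup-∁ P (src e)) (lookup-∁ P (tgt e)) ⟩
    not (lookup P (src e)) xor not (lookup P (tgt e))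
      ≡⟨ not-xor-not (lookup P (src e)) (lookup P (tgt e)) ⟩
    lookup P (src e) xor lookup P (tgt e) ∎)
    where
    open ≡-Reasoning
    not-xor-not : ∀ a b → not a xor not b ≡ a xor b
    not-xor-not a b = trans (sym (Bool.not-distribˡ-xor a (not b)))
                            (trans (cong not (sym (Bool.not-distribʳ-xor a b))) (Bool.not-involutive _))

  ∂-submodular : ∀ P Q → ∂ (P ∩ Q) + ∂ (P ∪ Q) ≤ ∂ P + ∂ Q
  ∂-submodular P Q = sum-pair-≤ edge
    where
    edge : ∀ e → crossing (P ∩ Q) e + crossing (P ∪ Q) e ≤ crossing P e + crossing Q e
    edge e rewrite lookup-∩ P Q (src e) | lookup-∩ P Q (tgt e) | lookup-∪ P Q (src e) | lookup-∪ P Q (tgt e) =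
      xor-submodular (lookup P (src e)) (lookup P (tgt e)) (lookup Q (src e)) (lookup Q (tgt e))

  ∂-posimodular : ∀ P Q → ∂ (P ─ Q) + ∂ (Q ─ P) ≤ ∂ P + ∂ Q
  ∂-posimodular P Q = sum-pair-≤ edge
    where
    edge : ∀ e → crossing (P ─ Q) e + crossing (Q ─ P) e ≤ crossing P e + crossing Q e
    edge e rewrite lookup-─ P Q (src e) | lookup-─ P Q (tgt e) | lookup-─ Q P (src e) | lookup-─ Q P (tgt e) =
      xor-posimodular (lookup P (src e)) (lookup P (tgt e)) (lookup Q (src e)) (lookup Q (tgt e))

  ∂-split : ∀ P Q → ∂ P + 2 * edgesBetween G (P ∩ Q) (P ─ Q) ≡ ∂ (P ∩ Q) + ∂ (P ─ Q)
  ∂-split P Q = begin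
    ∂ P + 2 * edgesBetween G (P ∩ Q) (P ─ Q)
      ≡⟨ cong (λ k → ∂ P + 2 * k) (edgesBetween-sum _ _) ⟩
    ∂ P + 2 * sum (between (P ∩ Q) (P ─ Q))
      ≡⟨ cong (∂ P +_) (ℕ-Sum.*-distribˡ-sum 2 (between (P ∩ Q) (P ─ Q))) ⟩
    ∂ P + sum (λ e → 2 * between (P ∩ Q) (P ─ Q) e)
      ≡⟨ sum-pair-≡ edge ⟩
    ∂ (P ∩ Q) + ∂ (P ─ Q) ∎
    where
    open ≡-Reasoning
    edge : ∀ e → crossing P e + 2 * between (P ∩ Q) (P ─ Q) e ≡ crossing (P ∩ Q) e + crossing (P ─ Q) e
    edge e rewrite lookup-∩ P Q (src e) | lookup-∩ P Q (tgt e) | lookup-─ P Q (src e) | lookup-─ P Q (tgt e) =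
      xor-split (lookup P (src e)) (lookup P (tgt e)) (lookup Q (src e)) (lookup Q (tgt e))

  ∂-disjoint-∪ : ∀ P Q → Empty (P ∩ Q) → ∂ (P ∪ Q) + 2 * edgesBetween G P Q ≡ ∂ P + ∂ Q
  ∂-disjoint-∪ P Q P∩Q≡∅ = begin
    ∂ (P ∪ Q) + 2 * edgesBetween G P Q
      ≡⟨ cong (λ k → ∂ (P ∪ Q) + 2 * k) (edgesBetween-sum P Q) ⟩
    ∂ (P ∪ Q) + 2 * sum (between P Q)
      ≡⟨ cong (∂ (P ∪ Q) +_) (ℕ-Sum.*-distribˡ-sum 2 (between P Q)) ⟩
    ∂ (P ∪ Q) + sum (λ e → 2 * between P Q e)
      ≡⟨ sum-pair-≡ edge ⟩
    ∂ P + ∂ Q ∎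
    where
    open ≡-Reasoning
    disjoint : ∀ v → lookup P v ∧ lookup Q v ≡ false
    disjoint v = trans (sym (lookup-∩ P Q v)) (∉⇒lookup λ v∈P∩Q → P∩Q≡∅ (v , v∈P∩Q))
    edge : ∀ e → crossing (P ∪ Q) e + 2 * between P Q e ≡ crossing P e + crossing Q e
    edge e rewrite lookup-∪ P Q (src e) | lookup-∪ P Q (tgt e) =
      xor-disjoint-∨ (lookup P (src e)) (lookup P (tgt e)) (lookup Q (src e)) (lookup Q (tgt e))
                     (disjoint (src e)) (disjoint (tgt e))

  adjacent⇒edgesBetween-pos : ∀ {P Q} → Adjacent P Q → 1 ≤ edgesBetween G P Q
  adjacent⇒edgesBetween-pos {P} {Q} (e , adj) =
    subst₂ _≤_ (one adj) (sym (edgesBetween-sum P Q)) (term≤sum (between P Q) e)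
    where
    one : (src e ∈ P × tgt e ∈ Q) ⊎ (src e ∈ Q × tgt e ∈ P) → between P Q e ≡ 1
    one (inj₁ (s∈P , t∈Q)) rewrite []=⇒lookup s∈P | []=⇒lookup t∈Q = refl
    one (inj₂ (s∈Q , t∈P)) rewrite []=⇒lookup s∈Q | []=⇒lookup t∈P =
      cong 𝟙 (Bool.∨-zeroʳ (lookup P (src e) ∧ lookup Q (tgt e)))

  ¬adjacent⇒edgesBetween≡0 : ∀ {P Q} → ¬ Adjacent P Q → edgesBetween G P Q ≡ 0
  ¬adjacent⇒edgesBetween≡0 {P} {Q} ¬adj = begin
    edgesBetween G P Q         ≡⟨ edgesBetween-sum P Q ⟩
    sum (between P Q)          ≡⟨ sum-cong-≗ none ⟩
    sum (replicate m 0)        ≡⟨ ℕ-Sum.sum-replicate-zero m ⟩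
    0                          ∎
    where
    open ≡-Reasoning
    none : ∀ e → between P Q e ≡ 0
    none e with lookup P (src e) in s∈P | lookup Q (tgt e) in t∈Q
              | lookup Q (src e) in s∈Q | lookup P (tgt e) in t∈P
    ... | true  | true  | _     | _     = contradiction (e , inj₁ (lookup⇒[]= _ P s∈P , lookup⇒[]= _ Q t∈Q)) ¬adj
    ... | _     | _     | true  | true  = contradiction (e , inj₂ (lookup⇒[]= _ Q s∈Q , lookup⇒[]= _ P t∈P)) ¬adj
    ... | true  | false | true  | false = refl
    ... | true  | false | false | _     = refl
    ... | false | _     | true  | false = refl
    ... | false | _     | false | _     = refl

  adjacent? : ∀ P Q → Dec (Adjacent P Q)
  adjacent? P Q = any? λ e → ((src e ∈? P) ×-dec (tgt e ∈? Q)) ⊎-dec ((src e ∈? Q) ×-dec (tgt e ∈? P))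

  ∂-split-unadjacent : ∀ P Q → ¬ Adjacent (P ∩ Q) (P ─ Q) → ∂ (P ∩ Q) + ∂ (P ─ Q) ≡ ∂ P
  ∂-split-unadjacent P Q ¬adj =
    trans (sym (∂-split P Q))
          (trans (cong (λ k → ∂ P + 2 * k) (¬adjacent⇒edgesBetween≡0 ¬adj)) (ℕ.+-identityʳ (∂ P)))

  joins-ends : ∀ {e u w} → Joins G e u w → (src e ≡ u × tgt e ≡ w) ⊎ (src e ≡ w × tgt e ≡ u)
  joins-ends (inj₁ eq) = inj₁ (cong proj₁ eq , cong proj₂ eq)
  joins-ends (inj₂ eq) = inj₂ (cong proj₁ eq , cong proj₂ eq)

  joins-sym : ∀ {e u w} → Joins G e u w → Joins G e w u
  joins-sym (inj₁ eq) = inj₂ eq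
  joins-sym (inj₂ eq) = inj₁ eq

  joins⇒adjacent : ∀ {e u w P Q} → Joins G e u w → u ∈ P → w ∈ Q → Adjacent P Q
  joins⇒adjacent {e} j u∈P w∈Q with joins-ends j
  ... | inj₁ (refl , refl) = e , inj₁ (u∈P , w∈Q)
  ... | inj₂ (refl , refl) = e , inj₂ (w∈Q , u∈P)

  ∂-∪-adjacent : ∀ {S T} → Empty (S ∩ T) → Adjacent S T → ∂ (S ∪ T) + 2 ≤ ∂ S + ∂ T
  ∂-∪-adjacent {S} {T} S∩T=∅ S~T =
    ℕ.≤-trans (ℕ.+-monoʳ-≤ (∂ (S ∪ T)) (ℕ.*-monoʳ-≤ 2 (adjacent⇒edgesBetween-pos S~T)))
              (ℕ.≤-reflexive (∂-disjoint-∪ S T S∩T=∅))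

  ∂-split-adjacent : ∀ {P Q} → Adjacent (P ∩ Q) (P ─ Q) → ∂ P + 2 ≤ ∂ (P ∩ Q) + ∂ (P ─ Q)
  ∂-split-adjacent {P} {Q} adj =
    ℕ.≤-trans (ℕ.+-monoʳ-≤ (∂ P) (ℕ.*-monoʳ-≤ 2 (adjacent⇒edgesBetween-pos adj)))
              (ℕ.≤-reflexive (∂-split P Q))

  adjacent⇒joins : ∀ {P Q} → Adjacent P Q → ∃[ e ] ∃[ a ] ∃[ b ] Joins G e a b × a ∈ P × b ∈ Q
  adjacent⇒joins (e , inj₁ (s∈P , t∈Q)) = e , _ , _ , inj₁ refl , s∈P , t∈Q
  adjacent⇒joins (e , inj₂ (s∈Q , t∈P)) = e , _ , _ , inj₂ refl , t∈P , s∈Q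

  adjacent-mono : ∀ {P P′ Q Q′} → P ⊆ P′ → Q ⊆ Q′ → Adjacent P Q → Adjacent P′ Q′
  adjacent-mono P⊆ Q⊆ (e , inj₁ (s∈P , t∈Q)) = e , inj₁ (P⊆ s∈P , Q⊆ t∈Q)
  adjacent-mono P⊆ Q⊆ (e , inj₂ (s∈Q , t∈P)) = e , inj₂ (Q⊆ s∈Q , P⊆ t∈P)

  adjacent-sym : ∀ {P Q} → Adjacent P Q → Adjacent Q P
  adjacent-sym (e , adj) = e , Sum.swap adj

  exit-crosses : ∀ {P e a b} → Joins G e a b → a ∈ P → b ∉ P → crossing P e ≡ 1
  exit-crosses j a∈P b∉P with joins-ends j
  ... | inj₁ (refl , refl) rewrite []=⇒lookup a∈P | ∉⇒lookup b∉P = refl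
  ... | inj₂ (refl , refl) rewrite []=⇒lookup a∈P | ∉⇒lookup b∉P = refl

  exit⇒∂-pos : ∀ {P e a b} → Joins G e a b → a ∈ P → b ∉ P → 1 ≤ ∂ P
  exit⇒∂-pos {P} {e} j a∈P b∉P = subst (_≤ ∂ P) (exit-crosses j a∈P b∉P) (term≤sum (crossing P) e)

  edgesBetween≤∂ : ∀ {C X} → (∀ u → u ∈ C → u ∉ X) → edgesBetween G C X ≤ ∂ C
  edgesBetween≤∂ {C} {X} disjoint = subst (_≤ ∂ C) (sym (edgesBetween-sum C X)) (sum-mono-≤ edge)
    where
    apart : ∀ v → lookup C v ∧ lookup X v ≡ false
    apart v with lookup C v in v∈C
    ... | false = refl
    ... | true  = ∉⇒lookup (disjoint v (lookup⇒[]= v C v∈C))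
    edge : ∀ e → between C X e ≤ crossing C e
    edge e = xor-bounds-between (lookup C (src e)) (lookup C (tgt e)) (lookup X (src e)) (lookup X (tgt e))
                                (apart (src e)) (apart (tgt e))

  start∈walkVerts : ∀ {a b} (p : Walk G a b) → a ∈ₗ walkVerts G p
  start∈walkVerts nil          = here refl
  start∈walkVerts (cons _ _ _) = here refl

  edge∈walk⇒ends∈walk : ∀ {a b e} (p : Walk G a b) → e ∈ₗ walkEdges G p →
                         src e ∈ₗ walkVerts G p × tgt e ∈ₗ walkVerts G p
  edge∈walk⇒ends∈walk (cons e j p) (here refl) with joins-ends j
  ... | inj₁ (refl , refl) = here refl , there (start∈walkVerts p)
  ... | inj₂ (refl , refl) = there (start∈walkVerts p) , here refl
  edge∈walk⇒ends∈walk (cons e j p) (there e∈p) = Product.map there there (edge∈walk⇒ends∈walk p e∈p)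

  path⇒edges-unique : ∀ {a b} (p : Walk G a b) → IsPath G p → Unique (walkEdges G p)
  path⇒edges-unique nil          _                  = []
  path⇒edges-unique (cons {a} e j p) (a≢p ∷ p-path) = All.tabulate e∉p ∷ path⇒edges-unique p p-path
    where
    a∉p : ¬ (a ∈ₗ walkVerts G p)
    a∉p a∈p = All.lookup a≢p a∈p refl
    e∉p : ∀ {e′} → e′ ∈ₗ walkEdges G p → e ≢ e′
    e∉p e′∈p refl with edge∈walk⇒ends∈walk p e′∈p | joins-ends j
    ... | s∈p , _ | inj₁ (s≡a , _) = a∉p (subst (_∈ₗ _) s≡a s∈p)
    ... | _ , t∈p | inj₂ (_ , t≡a) = a∉p (subst (_∈ₗ _) t≡a t∈p)

  record Exit {a b} (A : Subset n) (p : Walk G a b) : Set where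
    field
      edge    : E G
      inner   : V G
      outer   : V G
      joins   : Joins G edge inner outer
      inner∈A : inner ∈ A
      outer∉A : outer ∉ A
      edge∈p  : edge ∈ₗ walkEdges G p
      inner∈p : inner ∈ₗ walkVerts G p
      outer∈p : outer ∈ₗ walkVerts G p

  walk-exit : ∀ {a b} (A : Subset n) (p : Walk G a b) → a ∈ A → b ∉ A → Exit A p
  walk-exit A nil                 a∈A a∉A = contradiction a∈A a∉A
  walk-exit A (cons {w = w} e j p) a∈A b∉A with w ∈? A
  ... | no w∉A  = record { edge = e ; joins = j ; inner∈A = a∈A ; outer∉A = w∉A ; edge∈p = here refl
                         ; inner∈p = here refl ; outer∈p = there (start∈walkVerts p) }
  ... | yes w∈A = record { Exit exit ; edge∈p = there (edge∈p exit)
                         ; inner∈p = there (inner∈p exit) ; outer∈p = there (outer∈p exit) }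
    where
    exit : Exit A p
    exit = walk-exit A p w∈A b∉A
    open Exit

  data Direction : Set where
    forward backward : Direction

  opposite : Direction → Direction
  opposite forward  = backward
  opposite backward = forward

  tail head : E G → Direction → V G
  tail e forward  = src e
  tail e backward = tgt e
  head e forward  = tgt e
  head e backward = src e

  ∃-direction? : {P : Direction → Set} → (∀ d → Dec (P d)) → Dec (∃ P)
  ∃-direction? P? = Dec.map′ (λ { (inj₁ p) → forward , p ; (inj₂ p) → backward , p })
                             (λ { (forward , p) → inj₁ p ; (backward , p) → inj₂ p })
                             (P? forward ⊎-dec P? backward)

  data Step (Ok : E G → Direction → Set) : V G → V G → Set where
    step : ∀ e d → Ok e d → Step Ok (tail e d) (head e d)

  arc-joins : ∀ e d → Joins G e (tail e d) (head e d)
  arc-joins e forward  = inj₁ refl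
  arc-joins e backward = inj₂ refl

  toWalk : ∀ {Ok u v} → Star (Step Ok) u v → Walk G u v
  toWalk ε                  = nil
  toWalk (step e d _ ◅ p) = cons e (arc-joins e d) (toWalk p)

  edges : ∀ {Ok u v} → Star (Step Ok) u v → List (E G)
  edges p = walkEdges G (toWalk p)

  edge-ok : ∀ {Ok u v e} (p : Star (Step Ok) u v) → e ∈ₗ edges p → ∃ (Ok e)
  edge-ok (step e d ok ◅ p) (here refl) = d , ok
  edge-ok (step e d ok ◅ p) (there e∈p) = edge-ok p e∈p

  weaken-step : ∀ {Ok Ok′ : E G → Direction → Set} → (∀ {e d} → Ok e d → Ok′ e d) →
                ∀ {u w} → Step Ok u w → Step Ok′ u w
  weaken-step h (step e d ok) = step e d (h ok)

  toWalk-weaken : ∀ {Ok Ok′ : E G → Direction → Set} (h : ∀ {e d} → Ok e d → Ok′ e d)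
                  {u v} (p : Star (Step Ok) u v) → toWalk (Star.map (weaken-step h) p) ≡ toWalk p
  toWalk-weaken h ε                  = refl
  toWalk-weaken h (step e d _ ◅ p) = cong (cons e (arc-joins e d)) (toWalk-weaken h p)

  record ReachingSet (Ok : E G → Direction → Set) (t : V G) : Set where
    field
      members  : Subset n
      target∈  : t ∈ members
      closed   : ∀ {u w} → Step Ok u w → w ∈ members → u ∈ members
      path     : ∀ {v} → v ∈ members → Σ (Star (Step Ok) v t) (IsPath G ∘ toWalk)

  SimplePathsWithin : (E G → Direction → Set) → V G → Subset n → Set
  SimplePathsWithin Ok t T = ∀ {v} → v ∈ T →
    Σ (Star (Step Ok) v t) λ p → IsPath G (toWalk p) × All.All (_∈ T) (walkVerts G (toWalk p))

  simple-paths-extend : ∀ {Ok t T e d} → Ok e d → head e d ∈ T → tail e d ∉ T →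
                        SimplePathsWithin Ok t T → SimplePathsWithin Ok t (⁅ tail e d ⁆ ∪ T)
  simple-paths-extend {T = T} {e} {d} ok w∈T u∉T paths {v} v∈T′ with x∈p∪q⁻ ⁅ tail e d ⁆ T v∈T′
  ... | inj₂ v∈T = Product.map₂ (Product.map₂ (All.map (q⊆p∪q _ T))) (paths v∈T)
  ... | inj₁ v∈⁅u⁆ with x∈⁅y⁆⇒x≡y (tail e d) v∈⁅u⁆ | paths w∈T
  ...   | refl | p , p-path , p⊆T =
    step e d ok ◅ p , All.map (λ x∈T u≡x → u∉T (subst (_∈ T) (sym u≡x) x∈T)) p⊆T ∷ p-path ,
    v∈T′ All.∷ All.map (q⊆p∪q _ T) p⊆T

  reachingSet : ∀ {Ok} → (∀ e d → Dec (Ok e d)) → ∀ t → ReachingSet Ok t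
  reachingSet {Ok} Ok? t = grow ⁅ t ⁆ (⊃-wellFounded ⁅ t ⁆) (x∈⁅x⁆ t) trivial-path
    where
    trivial-path : SimplePathsWithin Ok t ⁅ t ⁆
    trivial-path v∈⁅t⁆ with x∈⁅y⁆⇒x≡y t v∈⁅t⁆
    ... | refl = ε , All.[] ∷ [] , v∈⁅t⁆ All.∷ All.[]

    Entering : Subset n → Set
    Entering T = ∃[ e ] ∃[ d ] Ok e d × head e d ∈ T × tail e d ∉ T

    entering? : ∀ T → Dec (Entering T)
    entering? T = any? λ e → ∃-direction? λ d → Ok? e d ×-dec head e d ∈? T ×-dec ¬? (tail e d ∈? T)

    grow : ∀ T → Acc _⊃_ T → t ∈ T → SimplePathsWithin Ok t T → ReachingSet Ok t
    grow T _ t∈T paths with entering? T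
    grow T _ t∈T paths | no nothing-enters = record
      { members = T ; target∈ = t∈T ; path = λ v∈T → Product.map₂ proj₁ (paths v∈T) ; closed = closed }
      where
      closed : ∀ {u w} → Step Ok u w → w ∈ T → u ∈ T
      closed (step e d ok) w∈T with tail e d ∈? T
      ... | yes u∈T = u∈T
      ... | no  u∉T = contradiction (e , d , ok , w∈T , u∉T) nothing-enters
    grow T (acc larger) t∈T paths | yes (e , d , ok , w∈T , u∉T) =
      grow (⁅ tail e d ⁆ ∪ T) (larger (q⊆p∪q _ T , tail e d , p⊆p∪q T (x∈⁅x⁆ (tail e d)) , u∉T))
           (q⊆p∪q _ T t∈T) (simple-paths-extend ok w∈T u∉T paths)

  ForwardClosed : (E G → Direction → Set) → Subset n → Set
  ForwardClosed Ok R = ∀ {u w} → Step Ok u w → u ∈ R → w ∈ R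

  complement-closed : ∀ {Ok t} (basin : ReachingSet Ok t) → ForwardClosed Ok (∁ (ReachingSet.members basin))
  complement-closed basin st u∈∁B =
    x∉p⇒x∈∁p λ w∈B → x∈∁p⇒x∉p u∈∁B (ReachingSet.closed basin st w∈B)

  AvoidingArc : Subset n → E G → Direction → Set
  AvoidingArc K e d = tail e d ∉ K × head e d ∉ K

  avoiding-step : ∀ {K e u w} → Joins G e u w → u ∉ K → w ∉ K → Step (AvoidingArc K) u w
  avoiding-step (inj₁ refl) u∉K w∉K = step _ forward (u∉K , w∉K)
  avoiding-step (inj₂ refl) u∉K w∉K = step _ backward (u∉K , w∉K)

  reverse-avoiding : ∀ {K u w} → Step (AvoidingArc K) u w → Step (AvoidingArc K) w u
  reverse-avoiding (step e d (u∉K , w∉K)) = avoiding-step (joins-sym (arc-joins e d)) w∉K u∉K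

  toWalk-avoids : ∀ {K u v} (p : Star (Step (AvoidingArc K)) u v) → u ∉ K → Avoids G K (toWalk p)
  toWalk-avoids ε                           u∉K _ (here refl) = u∉K
  toWalk-avoids (step e d (_ , w∉K) ◅ p) u∉K _ (here refl) = u∉K
  toWalk-avoids (step e d (_ , w∉K) ◅ p) u∉K x (there x∈p) = toWalk-avoids p w∉K x x∈p

  component : ∀ K {z} → z ∉ K → ∃[ C ] z ∈ C × IsComponentMinus G K C
  component K {z} z∉K = members , target∈ , (z , target∈) , disjoint , connected , walk-closed
    where
    open ReachingSet (reachingSet (λ e d → ¬? (tail e d ∈? K) ×-dec ¬? (head e d ∈? K)) z)
    start∉K : ∀ {v} → Star (Step (AvoidingArc K)) v z → v ∉ K
    start∉K ε                            = z∉K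
    start∉K (step e d (u∉K , _) ◅ _) = u∉K
    disjoint : ∀ u → u ∈ members → u ∉ K
    disjoint u u∈C = start∉K (proj₁ (path u∈C))
    connected : ∀ u v → u ∈ members → v ∈ members → ConnectedIn- G K u v
    connected u v u∈C v∈C = toWalk p , toWalk-avoids p (disjoint u u∈C)
      where
      p : Star (Step (AvoidingArc K)) u v
      p = proj₁ (path u∈C) ◅◅ Star.reverse reverse-avoiding (proj₁ (path v∈C))
    walk-closed : ∀ u v → u ∈ members → ConnectedIn- G K u v → v ∈ members
    walk-closed u v u∈C (p , avoids) = along p avoids u∈C
      where
      along : ∀ {a} (p : Walk G a v) → Avoids G K p → a ∈ members → v ∈ members
      along nil                  _      a∈C = a∈C
      along (cons {w = w} e j p) avoids a∈C =
        along p (λ x x∈p → avoids x (there x∈p))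
              (closed (avoiding-step (joins-sym j) (avoids w (there (start∈walkVerts p))) (disjoint _ a∈C)) a∈C)

  component-step : ∀ {K C e u w} → IsComponentMinus G K C → u ∈ C → Joins G e u w → w ∉ K → w ∈ C
  component-step {e = e} (_ , disjoint , _ , closed) u∈C j w∉K =
    closed _ _ u∈C (cons e j nil , λ { _ (here refl) → disjoint _ u∈C ; _ (there (here refl)) → w∉K })

  component-walk : ∀ {K C a b} → IsComponentMinus G K C → a ∈ C → (p : Walk G a b) → Avoids G K p →
                   ∀ v → v ∈ₗ walkVerts G p → v ∈ C
  component-walk comp a∈C nil          avoids _ (here refl) = a∈C
  component-walk comp a∈C (cons e j p) avoids _ (here refl) = a∈C
  component-walk comp a∈C (cons e j p) avoids v (there v∈p) =
    component-walk comp (component-step comp a∈C j (avoids _ (there (start∈walkVerts p)))) p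
                   (λ x x∈p → avoids x (there x∈p)) v v∈p

  IsConnected : Subset n → Set
  IsConnected S = ∀ A → Nonempty (S ∩ A) → Nonempty (S ─ A) → Adjacent (S ∩ A) (S ─ A)

  connected? : ∀ S → Dec (IsConnected S)
  connected? S
    with anySubset? {n = n} (λ A → nonempty? (S ∩ A) ×-dec nonempty? (S ─ A) ×-dec ¬? (adjacent? (S ∩ A) (S ─ A)))
  ... | yes (A , S∩A , S─A , ¬adj) = no λ connected → ¬adj (connected A S∩A S─A)
  ... | no  none = yes λ A S∩A S─A →
    Dec.decidable-stable (adjacent? (S ∩ A) (S ─ A)) λ ¬adj → none (A , S∩A , S─A , ¬adj)

  component-connected : ∀ {K C} → IsComponentMinus G K C → IsConnected C
  component-connected {C = C} comp@(_ , _ , connected , _) A (a , a∈C∩A) (b , b∈C─A)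
    with x∈p∩q⁻ C A a∈C∩A | x∈p─q⁻ C A b∈C─A
  ... | a∈C , a∈A | b∈C , b∉A with connected a b a∈C b∈C
  ...   | p , p-avoids with walk-exit A p a∈A b∉A
  ...     | record { joins = j ; inner∈A = u∈A ; outer∉A = w∉A ; inner∈p = u∈p ; outer∈p = w∈p } =
    joins⇒adjacent j (x∈p∩q⁺ (on-p⇒∈C u∈p , u∈A)) (x∈p∧x∉q⇒x∈p─q (on-p⇒∈C w∈p) w∉A)
    where
    on-p⇒∈C : ∀ {v} → v ∈ₗ walkVerts G p → v ∈ C
    on-p⇒∈C = component-walk comp a∈C p p-avoids _

  -- A flow with unit capacities: the direction in which each edge carries its unit, if it is used.
  Flow : Set
  Flow = Vector (Maybe Direction) m

  Cancels : Flow → E G → Direction → Set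
  Cancels f e d = f e ≡ just (opposite d)

  data Residual (f : Flow) (e : E G) (d : Direction) : Set where
    unused  : f e ≡ nothing → Residual f e d
    cancels : Cancels f e d → Residual f e d

  _≟ᵈ_ : DecidableEquality Direction
  forward  ≟ᵈ forward  = yes refl
  forward  ≟ᵈ backward = no λ ()
  backward ≟ᵈ forward  = no λ ()
  backward ≟ᵈ backward = yes refl

  cancels? : ∀ f e d → Dec (Cancels f e d)
  cancels? f e d = Maybe.≡-dec _≟ᵈ_ (f e) (just (opposite d))

  residual? : ∀ f e d → Dec (Residual f e d)
  residual? f e d = Dec.map′ [ unused , cancels ]′ from (Maybe.≡-dec _≟ᵈ_ (f e) nothing ⊎-dec cancels? f e d)
    where
    from : Residual f e d → f e ≡ nothing ⊎ Cancels f e d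
    from (unused fe≡∅)  = inj₁ fe≡∅
    from (cancels fe≡d) = inj₂ fe≡d

  δ : V G → V G → ℤ
  δ a v = if does (a ≟ v) then ℤ.1ℤ else ℤ.0ℤ

  contribution : Maybe Direction → E G → V G → ℤ
  contribution nothing  e v = ℤ.0ℤ
  contribution (just d) e v = δ (tail e d) v ℤ.- δ (head e d) v

  net : Flow → V G → ℤ
  net f v = ℤ-Sum.sum λ e → contribution (f e) e v

  IsFlow : V G → V G → ℕ → Flow → Set
  IsFlow s t k f = ∀ v → net f v ≡ ℤ.+ k ℤ.* (δ s v ℤ.- δ t v)

  rerouted : ∀ {f e d} → Residual f e d → Maybe Direction
  rerouted {d = d} (unused _)  = just d
  rerouted         (cancels _) = nothing

  reroute-shift : ∀ {f e d} (r : Residual f e d) v →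
    contribution (rerouted r) e v ℤ.- contribution (f e) e v ≡ δ (tail e d) v ℤ.- δ (head e d) v
  reroute-shift {e = e} {d} (unused fe≡∅) v =
    trans (cong (λ o → contribution (just d) e v ℤ.- contribution o e v) fe≡∅) (ℤ.+-identityʳ _)
  reroute-shift {e = e} {d} (cancels fe≡d⁻) v =
    trans (cong (λ o → ℤ.0ℤ ℤ.- contribution o e v) fe≡d⁻) (undo d)
    where
    negate-difference : ∀ a b → ℤ.0ℤ ℤ.- (b ℤ.- a) ≡ a ℤ.- b
    negate-difference = solve-∀
    undo : ∀ d → ℤ.0ℤ ℤ.- contribution (just (opposite d)) e v ≡ δ (tail e d) v ℤ.- δ (head e d) v
    undo forward  = negate-difference (δ (src e) v) (δ (tgt e) v)
    undo backward = negate-difference (δ (tgt e) v) (δ (src e) v)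

  net-update : ∀ f e o v →
    net (updateAt f e (const o)) v ≡ net f v ℤ.+ (contribution o e v ℤ.- contribution (f e) e v)
  net-update f e o v =
    trans (sum-update (λ e′ → contribution (f e′) e′ v) (λ e′ → contribution (updateAt f e (const o) e′) e′ v)
                      e λ e′ e′≢e → cong (λ x → contribution x e′ v) (updateAt-minimal e′ e f e′≢e))
          (cong (λ x → net f v ℤ.+ (contribution x e v ℤ.- contribution (f e) e v)) (updateAt-updates e f))

  reroute-net : ∀ {f₀ e d} (r : Residual f₀ e d) f → f e ≡ f₀ e → ∀ v →
    net (updateAt f e (const (rerouted r))) v ≡ net f v ℤ.+ (δ (tail e d) v ℤ.- δ (head e d) v)
  reroute-net {e = e} r f fe≡f₀e v =
    trans (net-update f e (rerouted r) v)
          (cong (ℤ._+_ (net f v)) (trans (cong (λ o → contribution (rerouted r) e v ℤ.- contribution o e v) fe≡f₀e)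
                                         (reroute-shift r v)))

  rerouted-clears : ∀ {f e d} (r : Residual f e d) → f e ≡ nothing ⊎ rerouted r ≡ nothing
  rerouted-clears (unused fe≡∅) = inj₁ fe≡∅
  rerouted-clears (cancels _)   = inj₂ refl

  Augmentation : ∀ {f₀ a b} → Star (Step (Residual f₀)) a b → Flow → Set
  Augmentation {f₀} {a} {b} p f = ∃[ f′ ]
      (∀ v → net f′ v ≡ net f v ℤ.+ (δ a v ℤ.- δ b v))
    × (∀ {e} → ¬ e ∈ₗ edges p → f′ e ≡ f e)
    × (∀ {e} → e ∈ₗ edges p → f₀ e ≡ nothing ⊎ f′ e ≡ nothing)

  -- The path is residual for f₀, and f is f₀ after rerouting the arcs before it, so f agrees with f₀
  -- on the remaining edges.
  augment : ∀ {f₀ a b} (p : Star (Step (Residual f₀)) a b) → Unique (edges p) →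
            ∀ f → (∀ {e} → e ∈ₗ edges p → f e ≡ f₀ e) → Augmentation p f
  augment {a = a} ε _ f _ = f , (λ v → no-shift (net f v) (δ a v)) , (λ _ → refl) , λ ()
    where
    no-shift : ∀ x y → x ≡ x ℤ.+ (y ℤ.- y)
    no-shift = solve-∀
  augment {f₀} {b = b} (step e d r ◅ p) (e∉p ∷ p-unique) f agree = extend (augment p p-unique f₁ agree₁)
    where
    f₁ : Flow
    f₁ = updateAt f e (const (rerouted r))
    agree₁ : ∀ {e′} → e′ ∈ₗ edges p → f₁ e′ ≡ f₀ e′
    agree₁ e′∈p = trans (updateAt-minimal _ e f λ e′≡e → All.lookup e∉p e′∈p (sym e′≡e))
                        (agree (there e′∈p))
    telescope : ∀ x a z b → (x ℤ.+ (a ℤ.- z)) ℤ.+ (z ℤ.- b) ≡ x ℤ.+ (a ℤ.- b)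
    telescope = solve-∀
    extend : Augmentation p f₁ → Augmentation (step e d r ◅ p) f
    extend (f′ , shift , unchanged , cleared) = f′ , shift′ , unchanged′ , cleared′
      where
      shift′ : ∀ v → net f′ v ≡ net f v ℤ.+ (δ (tail e d) v ℤ.- δ b v)
      shift′ v = trans (shift v)
        (trans (cong (λ x → x ℤ.+ (δ (head e d) v ℤ.- δ b v)) (reroute-net r f (agree (here refl)) v))
               (telescope (net f v) (δ (tail e d) v) (δ (head e d) v) (δ b v)))
      unchanged′ : ∀ {e′} → ¬ e′ ∈ₗ edges (step e d r ◅ p) → f′ e′ ≡ f e′
      unchanged′ e′∉ = trans (unchanged (e′∉ ∘ there)) (updateAt-minimal _ e f (e′∉ ∘ here))
      cleared′ : ∀ {e′} → e′ ∈ₗ edges (step e d r ◅ p) → f₀ e′ ≡ nothing ⊎ f′ e′ ≡ nothing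
      cleared′ (there e′∈p) = cleared e′∈p
      cleared′ (here refl)  =
        Sum.map₂ (trans (trans (unchanged λ e∈p → All.lookup e∉p e∈p refl) (updateAt-updates e f)))
                 (rerouted-clears r)

  ⟦_∈_⟧ : V G → Subset n → ℤ
  ⟦ v ∈ R ⟧ = ℤ.+ 𝟙 (lookup R v)

  outflow : Subset n → Maybe Direction → E G → ℤ
  outflow R nothing  e = ℤ.0ℤ
  outflow R (just d) e = ⟦ tail e d ∈ R ⟧ ℤ.- ⟦ head e d ∈ R ⟧

  sum-indicator-δ : ∀ R a → ℤ-Sum.sum (λ v → ⟦ v ∈ R ⟧ ℤ.* δ a v) ≡ ⟦ a ∈ R ⟧
  sum-indicator-δ R a =
    trans (sum-pointed ℤ.+-0-commutativeMonoid (λ v → ⟦ v ∈ R ⟧ ℤ.* δ a v) a vanishes)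
          (trans (cong (λ b → ⟦ a ∈ R ⟧ ℤ.* (if b then ℤ.1ℤ else ℤ.0ℤ)) (dec-true (a ≟ a) refl))
                 (ℤ.*-identityʳ ⟦ a ∈ R ⟧))
    where
    vanishes : ∀ v → v ≢ a → ⟦ v ∈ R ⟧ ℤ.* δ a v ≡ ℤ.0ℤ
    vanishes v v≢a =
      trans (cong (λ b → ⟦ v ∈ R ⟧ ℤ.* (if b then ℤ.1ℤ else ℤ.0ℤ)) (dec-false (a ≟ v) (v≢a ∘ sym)))
            (ℤ.*-zeroʳ ⟦ v ∈ R ⟧)

  sum-indicator-difference : ∀ R a b →
    ℤ-Sum.sum (λ v → ⟦ v ∈ R ⟧ ℤ.* (δ a v ℤ.- δ b v)) ≡ ⟦ a ∈ R ⟧ ℤ.- ⟦ b ∈ R ⟧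
  sum-indicator-difference R a b = begin
    ℤ-Sum.sum (λ v → ⟦ v ∈ R ⟧ ℤ.* (δ a v ℤ.- δ b v))
      ≡⟨ ℤ-Sum.sum-cong-≗ (λ v → distrib ⟦ v ∈ R ⟧ (δ a v) (δ b v)) ⟩
    ℤ-Sum.sum (λ v → ⟦ v ∈ R ⟧ ℤ.* δ a v ℤ.- ⟦ v ∈ R ⟧ ℤ.* δ b v)
      ≡⟨ ∑-distrib-− (λ v → ⟦ v ∈ R ⟧ ℤ.* δ a v) (λ v → ⟦ v ∈ R ⟧ ℤ.* δ b v) ⟩
    ℤ-Sum.sum (λ v → ⟦ v ∈ R ⟧ ℤ.* δ a v) ℤ.- ℤ-Sum.sum (λ v → ⟦ v ∈ R ⟧ ℤ.* δ b v)
      ≡⟨ cong₂ ℤ._-_ (sum-indicator-δ R a) (sum-indicator-δ R b) ⟩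
    ⟦ a ∈ R ⟧ ℤ.- ⟦ b ∈ R ⟧ ∎
    where
    open ≡-Reasoning
    distrib : ∀ x y z → x ℤ.* (y ℤ.- z) ≡ x ℤ.* y ℤ.- x ℤ.* z
    distrib = solve-∀

  outflow-sum : ∀ R o e → outflow R o e ≡ ℤ-Sum.sum (λ v → ⟦ v ∈ R ⟧ ℤ.* contribution o e v)
  outflow-sum R nothing  e =
    sym (trans (ℤ-Sum.sum-cong-≗ λ v → ℤ.*-zeroʳ ⟦ v ∈ R ⟧) (ℤ-Sum.sum-replicate-zero n))
  outflow-sum R (just d) e = sym (sum-indicator-difference R (tail e d) (head e d))

  flow-across-cut : ∀ {s t k f} → IsFlow s t k f → ∀ R →
    ℤ-Sum.sum (λ e → outflow R (f e) e) ≡ ℤ.+ k ℤ.* (⟦ s ∈ R ⟧ ℤ.- ⟦ t ∈ R ⟧)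
  flow-across-cut {s} {t} {k} {f} f-flow R = begin
    ℤ-Sum.sum (λ e → outflow R (f e) e)
      ≡⟨ ℤ-Sum.sum-cong-≗ (λ e → outflow-sum R (f e) e) ⟩
    ℤ-Sum.sum (λ e → ℤ-Sum.sum λ v → ⟦ v ∈ R ⟧ ℤ.* contribution (f e) e v)
      ≡⟨ ℤ-Sum.∑-comm (λ e v → ⟦ v ∈ R ⟧ ℤ.* contribution (f e) e v) ⟩
    ℤ-Sum.sum (λ v → ℤ-Sum.sum λ e → ⟦ v ∈ R ⟧ ℤ.* contribution (f e) e v)
      ≡⟨ ℤ-Sum.sum-cong-≗ (λ v → ℤ-Sum.*-distribˡ-sum ⟦ v ∈ R ⟧ (λ e → contribution (f e) e v)) ⟨
    ℤ-Sum.sum (λ v → ⟦ v ∈ R ⟧ ℤ.* net f v)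
      ≡⟨ ℤ-Sum.sum-cong-≗ (λ v → trans (cong (ℤ._*_ ⟦ v ∈ R ⟧) (f-flow v))
                                        (swap ⟦ v ∈ R ⟧ (ℤ.+ k) (δ s v ℤ.- δ t v))) ⟩
    ℤ-Sum.sum (λ v → ℤ.+ k ℤ.* (⟦ v ∈ R ⟧ ℤ.* (δ s v ℤ.- δ t v)))
      ≡⟨ ℤ-Sum.*-distribˡ-sum (ℤ.+ k) (λ v → ⟦ v ∈ R ⟧ ℤ.* (δ s v ℤ.- δ t v)) ⟨
    ℤ.+ k ℤ.* ℤ-Sum.sum (λ v → ⟦ v ∈ R ⟧ ℤ.* (δ s v ℤ.- δ t v))
      ≡⟨ cong (ℤ._*_ (ℤ.+ k)) (sum-indicator-difference R s t) ⟩
    ℤ.+ k ℤ.* (⟦ s ∈ R ⟧ ℤ.- ⟦ t ∈ R ⟧) ∎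
    where
    open ≡-Reasoning
    swap : ∀ x y z → x ℤ.* (y ℤ.* z) ≡ y ℤ.* (x ℤ.* z)
    swap = solve-∀

  difference-closed : ∀ R {a b} → (b ∈ R → a ∈ R) →
                      ⟦ a ∈ R ⟧ ℤ.- ⟦ b ∈ R ⟧ ≡ ℤ.+ 𝟙 (lookup R a xor lookup R b)
  difference-closed R {a} {b} b⇒a with lookup R a in a∈R | lookup R b in b∈R
  ... | true  | true  = refl
  ... | true  | false = refl
  ... | false | false = refl
  ... | false | true  with trans (sym ([]=⇒lookup (b⇒a (lookup⇒[]= b R b∈R)))) a∈R
  ...   | ()

  outflow-cancels : ∀ {f R e d} → ForwardClosed (Cancels f) R → f e ≡ just d →
                    outflow R (just d) e ≡ ℤ.+ crossing R e
  outflow-cancels {R = R} {e} {forward}  closed fe≡d = difference-closed R (closed (step e backward fe≡d))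
  outflow-cancels {R = R} {e} {backward} closed fe≡d =
    trans (difference-closed R (closed (step e forward fe≡d)))
          (cong (ℤ.+_ ∘ 𝟙) (Bool.xor-comm (lookup R (tgt e)) (lookup R (src e))))

  outflow-residual : ∀ {f R} → ForwardClosed (Residual f) R → ∀ e → outflow R (f e) e ≡ ℤ.+ crossing R e
  outflow-residual {f} {R} closed e with f e in fe
  ... | just d  = outflow-cancels (closed ∘ weaken-step cancels) fe
  ... | nothing = cong ℤ.+_ (sym uncrossed)
    where
    uncrossed : crossing R e ≡ 0
    uncrossed with lookup R (src e) in s∈R | lookup R (tgt e) in t∈R
    ... | true  | true  = refl
    ... | false | false = refl
    ... | true  | false = contradiction (closed (step e forward (unused fe)) (lookup⇒[]= _ R s∈R)) (λ t∈R′ →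
                            case trans (sym ([]=⇒lookup t∈R′)) t∈R of λ ())
    ... | false | true  = contradiction (closed (step e backward (unused fe)) (lookup⇒[]= _ R t∈R)) (λ s∈R′ →
                            case trans (sym ([]=⇒lookup s∈R′)) s∈R of λ ())

  cut-value : ∀ {s t k f R} → IsFlow s t k f → s ∈ R → t ∉ R → ForwardClosed (Residual f) R → ∂ R ≡ k
  cut-value {s} {t} {k} {f} {R} f-flow s∈R t∉R closed = ℤ.+-injective (begin
    ℤ.+ ∂ R
      ≡⟨ pos-sum (crossing R) ⟨
    ℤ-Sum.sum (λ e → ℤ.+ crossing R e)
      ≡⟨ ℤ-Sum.sum-cong-≗ (outflow-residual closed) ⟨
    ℤ-Sum.sum (λ e → outflow R (f e) e)
      ≡⟨ flow-across-cut {k = k} {f} f-flow R ⟩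
    ℤ.+ k ℤ.* (⟦ s ∈ R ⟧ ℤ.- ⟦ t ∈ R ⟧)
      ≡⟨ cong₂ (λ x y → ℤ.+ k ℤ.* (ℤ.+ 𝟙 x ℤ.- ℤ.+ 𝟙 y)) ([]=⇒lookup s∈R) (∉⇒lookup t∉R) ⟩
    ℤ.+ k ℤ.* ℤ.1ℤ
      ≡⟨ ℤ.*-identityʳ _ ⟩
    ℤ.+ k ∎)
    where open ≡-Reasoning

  flow-leaves : ∀ {s t k f R} → IsFlow s t (suc k) f → t ∈ R → s ∉ R → ¬ ForwardClosed (Cancels f) R
  flow-leaves {s} {t} {k} {f} {R} f-flow t∈R s∉R closed = positive≢negative (begin
    ℤ.+ sum (proj₁ ∘ leaving)
      ≡⟨ pos-sum (proj₁ ∘ leaving) ⟨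
    ℤ-Sum.sum (λ e → ℤ.+ proj₁ (leaving e))
      ≡⟨ ℤ-Sum.sum-cong-≗ (proj₂ ∘ leaving) ⟨
    ℤ-Sum.sum (λ e → outflow R (f e) e)
      ≡⟨ flow-across-cut {k = suc k} {f} f-flow R ⟩
    ℤ.+ suc k ℤ.* (⟦ s ∈ R ⟧ ℤ.- ⟦ t ∈ R ⟧)
      ≡⟨ cong₂ (λ x y → ℤ.+ suc k ℤ.* (ℤ.+ 𝟙 x ℤ.- ℤ.+ 𝟙 y)) (∉⇒lookup s∉R) ([]=⇒lookup t∈R) ⟩
    ℤ.+ suc k ℤ.* (ℤ.0ℤ ℤ.- ℤ.1ℤ) ∎)
    where
    open ≡-Reasoning
    leaving : ∀ e → Σ ℕ λ N → outflow R (f e) e ≡ ℤ.+ N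
    leaving e with f e in fe
    ... | nothing = 0 , refl
    ... | just d  = crossing R e , outflow-cancels closed fe
    positive≢negative : ∀ {N} → ℤ.+ N ≢ ℤ.+ suc k ℤ.* (ℤ.0ℤ ℤ.- ℤ.1ℤ)
    positive≢negative ()

  flow-exists : ∀ {s t} k → (∀ P → s ∈ P → t ∉ P → k ≤ ∂ P) → ∃ (IsFlow s t k)
  flow-exists zero _ = const nothing , λ v → ℤ-Sum.sum-replicate-zero m
  flow-exists {s} {t} (suc k) cuts-large =
    augment-or-cut (flow-exists k λ P s∈P t∉P → ℕ.<⇒≤ (cuts-large P s∈P t∉P))
    where
    augment-or-cut : ∃ (IsFlow s t k) → ∃ (IsFlow s t (suc k))
    augment-or-cut (f , f-flow) with reachingSet (residual? f) t
    ... | basin with s ∈? ReachingSet.members basin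
    ...   | no s∉B = contradiction (cuts-large _ s∈R t∉R)
                                   (ℕ.<-irrefl (sym (cut-value f-flow s∈R t∉R (complement-closed basin))))
      where
      s∈R : s ∈ ∁ (ReachingSet.members basin)
      s∈R = x∉p⇒x∈∁p s∉B
      t∉R : t ∉ ∁ (ReachingSet.members basin)
      t∉R = x∈p⇒x∉∁p (ReachingSet.target∈ basin)
    ...   | yes s∈B with ReachingSet.path basin s∈B
    ...     | p , p-path with augment p (path⇒edges-unique (toWalk p) p-path) f (λ _ → refl)
    ...       | f′ , shift , _ = f′ , λ v →
      trans (shift v) (trans (cong (λ x → x ℤ.+ (δ s v ℤ.- δ t v)) (f-flow v))
                             (one-more (ℤ.+ k) (δ s v ℤ.- δ t v)))
      where
      one-more : ∀ K x → K ℤ.* x ℤ.+ x ≡ (ℤ.1ℤ ℤ.+ K) ℤ.* x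
      one-more = solve-∀

  record PathSystem (a b : V G) (k : ℕ) (f : Flow) : Set where
    field
      paths     : Vec (Walk G a b) k
      simple    : VecAll.All (IsPath G) paths
      disjoint  : VecAllPairs.AllPairs (EdgeDisjoint G) paths
      supported : VecAll.All (λ p → ∀ {e} → e ∈ₗ walkEdges G p → f e ≢ nothing) paths

  cancel-path-used : ∀ {f u v e} (p : Star (Step (Cancels f)) u v) → e ∈ₗ edges p → f e ≢ nothing
  cancel-path-used p e∈p fe≡∅ with edge-ok p e∈p
  ... | _ , fe≡d = case trans (sym fe≡∅) fe≡d of λ ()

  cancel-path : ∀ {s t k f} → IsFlow s t (suc k) f → (p : Star (Step (Cancels f)) t s) → IsPath G (toWalk p) →
                ∃[ f′ ] IsFlow s t k f′ × (∀ {e} → e ∈ₗ edges p → f′ e ≡ nothing)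
                                        × (∀ {e} → f e ≡ nothing → f′ e ≡ nothing)
  cancel-path {s} {t} {k} {f} f-flow p p-path = f′ , f′-flow , p-cleared , stays-unused
    where
    p⁺ : Star (Step (Residual f)) t s
    p⁺ = Star.map (weaken-step cancels) p
    same-walk : toWalk p⁺ ≡ toWalk p
    same-walk = toWalk-weaken cancels p
    augmented : Augmentation p⁺ f
    augmented = augment p⁺ (subst (Unique ∘ walkEdges G) (sym same-walk) (path⇒edges-unique (toWalk p) p-path))
                        f (λ _ → refl)
    f′ : Flow
    f′ = proj₁ augmented
    f′-flow : IsFlow s t k f′
    f′-flow v = trans (proj₁ (proj₂ augmented) v) (trans (cong (λ x → x ℤ.+ (δ t v ℤ.- δ s v)) (f-flow v))
                                                          (one-less (ℤ.+ k) (δ s v) (δ t v)))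
      where
      one-less : ∀ K a b → (ℤ.1ℤ ℤ.+ K) ℤ.* (a ℤ.- b) ℤ.+ (b ℤ.- a) ≡ K ℤ.* (a ℤ.- b)
      one-less = solve-∀
    p-cleared : ∀ {e} → e ∈ₗ edges p → f′ e ≡ nothing
    p-cleared e∈p with proj₂ (proj₂ (proj₂ augmented)) (subst (λ w → _ ∈ₗ walkEdges G w) (sym same-walk) e∈p)
    ... | inj₁ fe≡∅  = contradiction fe≡∅ (cancel-path-used p e∈p)
    ... | inj₂ f′e≡∅ = f′e≡∅
    stays-unused : ∀ {e} → f e ≡ nothing → f′ e ≡ nothing
    stays-unused {e} fe≡∅ with e ∈ₗ? edges p
    ... | yes e∈p = p-cleared e∈p
    ... | no  e∉p =
      trans (proj₁ (proj₂ (proj₂ augmented)) (e∉p ∘ subst (λ w → e ∈ₗ walkEdges G w) same-walk)) fe≡∅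

  -- The paths run from t to s: they are found by walking against the flow.
  decompose : ∀ {s t} k f → IsFlow s t k f → PathSystem t s k f
  decompose zero f _ = record { paths = [] ; simple = [] ; disjoint = [] ; supported = [] }
  decompose {s} {t} (suc k) f f-flow with reachingSet (cancels? f) s
  ... | basin with t ∈? ReachingSet.members basin
  ...   | no t∉B = ⊥-elim (flow-leaves {k = k} {f} f-flow (x∉p⇒x∈∁p t∉B)
                                   (x∈p⇒x∉∁p (ReachingSet.target∈ basin)) (complement-closed basin))
  ...   | yes t∈B with ReachingSet.path basin t∈B
  ...     | p , p-path with cancel-path {k = k} f-flow p p-path
  ...       | f′ , f′-flow , p-cleared , stays-unused = record
      { paths     = toWalk p ∷ paths
      ; simple    = p-path ∷ simple
      ; disjoint  = VecAll.map (λ q-supported _ e∈p e∈q → q-supported e∈q (p-cleared e∈p)) supported ∷ disjoint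
      ; supported = cancel-path-used p
                    ∷ VecAll.map (λ q-supported {_} e∈q → q-supported e∈q ∘ stays-unused) supported
      }
    where open PathSystem (decompose {s} {t} k f′ f′-flow)

  Linked : V G → V G → Set
  Linked u v = ∀ P → u ∈ P → v ∉ P → 2 < ∂ P

  linked⇒three-edge-connected : ∀ {s t} → Linked s t → ThreeEdgeConnected G t s
  linked⇒three-edge-connected {s} {t} linked = three-paths (decompose 3 (proj₁ flow) (proj₂ flow))
    where
    flow : ∃ (IsFlow s t 3)
    flow = flow-exists 3 linked
    -- Matching on a variable rather than on the decompose call keeps Agda from unfolding the
    -- well-founded recursion inside it.
    three-paths : ∀ {f} → PathSystem t s 3 f → ThreeEdgeConnected G t s
    three-paths record { paths    = p ∷ q ∷ r ∷ []
                       ; simple   = p-path ∷ q-path ∷ r-path ∷ []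
                       ; disjoint = (p∤q ∷ p∤r ∷ []) ∷ (q∤r ∷ []) ∷ [] ∷ [] } =
      p , q , r , p-path , q-path , r-path , p∤q , p∤r , q∤r

  three-edge-connected⇒linked : ∀ {u v} → ThreeEdgeConnected G u v → Linked u v
  three-edge-connected⇒linked (p , q , r , _ , _ , _ , p∤q , p∤r , q∤r) P u∈P v∉P =
    three≤sum (crossing P) (distinct p∤q) (distinct p∤r) (distinct q∤r)
              (crosses (exit p)) (crosses (exit q)) (crosses (exit r))
    where
    exit : ∀ w → Exit P w
    exit w = walk-exit P w u∈P v∉P
    crosses : ∀ {a b} {w : Walk G a b} (x : Exit P w) → 1 ≤ crossing P (Exit.edge x)
    crosses x = ℕ.≤-reflexive (sym (exit-crosses (Exit.joins x) (Exit.inner∈A x) (Exit.outer∉A x)))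
    distinct : ∀ {w w′ : Walk G _ _} → EdgeDisjoint G w w′ → Exit.edge (exit w) ≢ Exit.edge (exit w′)
    distinct {w} {w′} w∤w′ same =
      w∤w′ _ (Exit.edge∈p (exit w)) (subst (_∈ₗ walkEdges G w′) (sym same) (Exit.edge∈p (exit w′)))

  linked-refl : ∀ {u} → Linked u u
  linked-refl P u∈P u∉P = contradiction u∈P u∉P

  linked-sym : ∀ {u v} → Linked u v → Linked v u
  linked-sym u~v P v∈P u∉P = subst (2 <_) (∂-∁ P) (u~v (∁ P) (x∉p⇒x∈∁p u∉P) (x∈p⇒x∉∁p v∈P))

  linked-trans : ∀ {u v w} → Linked u v → Linked v w → Linked u w
  linked-trans {v = v} u~v v~w P u∈P w∉P with v ∈? P
  ... | yes v∈P = v~w P v∈P w∉P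
  ... | no  v∉P = u~v P u∈P v∉P

  Separated : V G → V G → Set
  Separated u v = ∃[ P ] u ∈ P × v ∉ P × ∂ P ≤ 2

  linked-or-separated : ∀ u v → Linked u v ⊎ Separated u v
  linked-or-separated u v with anySubset? (λ P → u ∈? P ×-dec ¬? (v ∈? P) ×-dec ∂ P ℕ.≤? 2)
  ... | yes separated = inj₂ separated
  ... | no  ¬separated = inj₁ λ P u∈P v∉P → ℕ.≰⇒> λ small → ¬separated (P , u∈P , v∉P , small)

  linked? : ∀ u v → Dec (Linked u v)
  linked? u v with linked-or-separated u v
  ... | inj₁ linked                  = yes linked
  ... | inj₂ (P , u∈P , v∉P , small) = no λ linked → ℕ.<⇒≱ (linked P u∈P v∉P) small

  cohesive⇒linked : ∀ {X u v} → Cohesive G X → u ∈ X → v ∈ X → Linked u v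
  cohesive⇒linked {u = u} {v} cohesive u∈X v∈X with u ≟ v
  ... | yes refl = linked-refl
  ... | no  u≢v  = three-edge-connected⇒linked (cohesive u v u∈X v∈X u≢v)

  linked⇒cohesive : ∀ {X} → (∀ {u v} → u ∈ X → v ∈ X → Linked u v) → Cohesive G X
  linked⇒cohesive linked u v u∈X v∈X _ = linked⇒three-edge-connected (linked v∈X u∈X)

  coreOf : V G → Subset n
  coreOf w = tabulate λ v → does (linked? w v)

  coreOf-intro : ∀ {w v} → Linked w v → v ∈ coreOf w
  coreOf-intro {w} {v} w~v = lookup⇒[]= v _ (trans (lookup∘tabulate _ v) (dec-true (linked? w v) w~v))

  coreOf-elim : ∀ {w v} → v ∈ coreOf w → Linked w v
  coreOf-elim {w} {v} v∈
    with linked? w v | trans (sym (lookup∘tabulate (λ v → does (linked? w v)) v)) ([]=⇒lookup v∈)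
  ... | yes w~v | _ = w~v

  coreOf-core : ∀ w → IsCore G (coreOf w)
  coreOf-core w = coreOf-cohesive , maximal
    where
    coreOf-cohesive : Cohesive G (coreOf w)
    coreOf-cohesive = linked⇒cohesive λ u∈ v∈ → linked-trans (linked-sym (coreOf-elim u∈)) (coreOf-elim v∈)
    maximal : ∀ Y → coreOf w ⊆ Y → Cohesive G Y → Y ⊆ coreOf w
    maximal Y ⊆Y Y-cohesive y∈Y = coreOf-intro (cohesive⇒linked Y-cohesive (⊆Y (coreOf-intro linked-refl)) y∈Y)

  core-unique : ∀ {X x} → IsCore G X → x ∈ X → X ≡ coreOf x
  core-unique {X} {x} (X-cohesive , X-maximal) x∈X =
    ⊆-antisym X⊆ (X-maximal (coreOf x) X⊆ (proj₁ (coreOf-core x)))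
    where
    X⊆ : X ⊆ coreOf x
    X⊆ v∈X = coreOf-intro (cohesive⇒linked X-cohesive x∈X v∈X)

  separated-from-core : ∀ {X c} → IsCore G X → c ∉ X → ∃[ x ] x ∈ X × Separated c x
  separated-from-core {X} {c} X-core@(_ , X-maximal) c∉X with any? (λ x → x ∈? X ×-dec ¬? (linked? c x))
  ... | yes (x , x∈X , c≁x) = x , x∈X , [ (λ c~x → contradiction c~x c≁x) , id ]′ (linked-or-separated c x)
  ... | no  none = contradiction (X-maximal (coreOf c) X⊆ (proj₁ (coreOf-core c)) (coreOf-intro linked-refl)) c∉X
    where
    X⊆ : X ⊆ coreOf c
    X⊆ {x} x∈X with linked? c x
    ... | yes c~x = coreOf-intro c~x
    ... | no  c≁x = contradiction (x , x∈X , c≁x) none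

  SmallCutAt : Subset n → V G → Subset n → Set
  SmallCutAt D w T = w ∈ T × T ⊆ D × ∂ T ≤ 2

  smallCutAt? : ∀ D w → Decidable (SmallCutAt D w)
  smallCutAt? D w T = w ∈? T ×-dec T ⊆? D ×-dec ∂ T ℕ.≤? 2

  small-cut-inside : ∀ {K D w} → IsCore G K → IsComponentMinus G K D → w ∈ D → ∃ (SmallCutAt D w)
  small-cut-inside {K} {D} {w} K-core@(K-cohesive , _) D-comp@(_ , disjoint , _ , _) w∈D
    with separated-from-core K-core (disjoint w w∈D)
  ... | x , x∈K , P , w∈P , x∉P , P-small =
    P ∩ D , x∈p∩q⁺ (w∈P , w∈D) , p∩q⊆q P D , ℕ.≤-trans restricted P-small
    where
    P-avoids-K : ∀ {v} → v ∈ P → v ∉ K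
    P-avoids-K v∈P v∈K = ℕ.<⇒≱ (cohesive⇒linked K-cohesive v∈K x∈K P v∈P x∉P) P-small
    ¬adjacent : ¬ Adjacent (P ∩ D) (P ─ D)
    ¬adjacent adj with adjacent⇒joins adj
    ... | e , a , b , j , a∈P∩D , b∈P─D with x∈p─q⁻ P D b∈P─D
    ... | b∈P , b∉D = b∉D (component-step D-comp (proj₂ (x∈p∩q⁻ P D a∈P∩D)) j (P-avoids-K b∈P))
    restricted : ∂ (P ∩ D) ≤ ∂ P
    restricted = subst (∂ (P ∩ D) ≤_) (∂-split-unadjacent P D ¬adjacent) (ℕ.m≤m+n _ _)

  MinimalSmallCutAt : Subset n → V G → Subset n → Set
  MinimalSmallCutAt D w T = SmallCutAt D w T × (∀ U → U ⊂ T → ¬ SmallCutAt D w U)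

  minimal-small-cut-connected : ∀ {D w T} → MinimalSmallCutAt D w T → IsConnected T
  minimal-small-cut-connected {D} {w} {T} ((w∈T , T⊆D , T-small) , minimal) A (a , a∈T∩A) (b , b∈T─A) =
    Dec.decidable-stable (adjacent? (T ∩ A) (T ─ A)) smaller-part
    where
    T∩A⊂T : T ∩ A ⊂ T
    T∩A⊂T = p∩q⊆p T A , b , proj₁ (x∈p─q⁻ T A b∈T─A) ,
            proj₂ (x∈p─q⁻ T A b∈T─A) ∘ proj₂ ∘ x∈p∩q⁻ T A
    smaller-part : ¬ Adjacent (T ∩ A) (T ─ A) → ⊥
    smaller-part ¬adj with ∂-split-unadjacent T A ¬adj | w ∈? A
    ... | parts | yes w∈A = minimal (T ∩ A) T∩A⊂T
      ( x∈p∩q⁺ (w∈T , w∈A) , T⊆D ∘ p∩q⊆p T A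
      , ℕ.≤-trans (subst (∂ (T ∩ A) ≤_) parts (ℕ.m≤m+n _ _)) T-small )
    ... | parts | no  w∉A = minimal (T ─ A) (p∩q≢∅⇒p─q⊂p T A (a , a∈T∩A))
      ( x∈p∧x∉q⇒x∈p─q w∈T w∉A , T⊆D ∘ p─q⊆p T A
      , ℕ.≤-trans (subst (∂ (T ─ A) ≤_) parts (ℕ.m≤n+m _ _)) T-small )

  ∪-connected : ∀ {S T} → IsConnected S → IsConnected T → Adjacent S T → IsConnected (S ∪ T)
  ∪-connected {S} {T} S-connected T-connected S~T A (a , a∈U∩A) (b , b∈U─A) =
    by-cases (nonempty? (S ∩ A)) (nonempty? (S ─ A)) (nonempty? (T ∩ A)) (nonempty? (T ─ A))
    where
    U : Subset n
    U = S ∪ T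
    ∩-mono : ∀ {X} → X ⊆ U → X ∩ A ⊆ U ∩ A
    ∩-mono X⊆U x∈X∩A = x∈p∩q⁺ (Product.map₁ X⊆U (x∈p∩q⁻ _ A x∈X∩A))
    ─-mono : ∀ {X} → X ⊆ U → X ─ A ⊆ U ─ A
    ─-mono X⊆U x∈X─A = Product.uncurry x∈p∧x∉q⇒x∈p─q (Product.map₁ X⊆U (x∈p─q⁻ _ A x∈X─A))
    inside : ∀ {X} → ¬ Nonempty (X ─ A) → X ⊆ U → X ⊆ U ∩ A
    inside X─A=∅ X⊆U {x} x∈X with x ∈? A
    ... | yes x∈A = x∈p∩q⁺ (X⊆U x∈X , x∈A)
    ... | no  x∉A = contradiction (x , x∈p∧x∉q⇒x∈p─q x∈X x∉A) X─A=∅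
    outside : ∀ {X} → ¬ Nonempty (X ∩ A) → X ⊆ U → X ⊆ U ─ A
    outside X∩A=∅ X⊆U x∈X = x∈p∧x∉q⇒x∈p─q (X⊆U x∈X) λ x∈A → X∩A=∅ (_ , x∈p∩q⁺ (x∈X , x∈A))
    by-cases : Dec (Nonempty (S ∩ A)) → Dec (Nonempty (S ─ A)) →
               Dec (Nonempty (T ∩ A)) → Dec (Nonempty (T ─ A)) → Adjacent (U ∩ A) (U ─ A)
    by-cases (yes S∩A) (yes S─A) _ _ =
      adjacent-mono (∩-mono (p⊆p∪q T)) (─-mono (p⊆p∪q T)) (S-connected A S∩A S─A)
    by-cases _ _ (yes T∩A) (yes T─A) =
      adjacent-mono (∩-mono (q⊆p∪q S T)) (─-mono (q⊆p∪q S T)) (T-connected A T∩A T─A)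
    by-cases _ (no S─A=∅) (no T∩A=∅) _ =
      adjacent-mono (inside S─A=∅ (p⊆p∪q T)) (outside T∩A=∅ (q⊆p∪q S T)) S~T
    by-cases (no S∩A=∅) _ _ (no T─A=∅) =
      adjacent-mono (inside T─A=∅ (q⊆p∪q S T)) (outside S∩A=∅ (p⊆p∪q T)) (adjacent-sym S~T)
    by-cases (no S∩A=∅) _ (no T∩A=∅) _ with x∈p∩q⁻ U A a∈U∩A
    ... | a∈U , a∈A = ⊥-elim ([ (λ a∈S → S∩A=∅ (a , x∈p∩q⁺ (a∈S , a∈A)))
                               , (λ a∈T → T∩A=∅ (a , x∈p∩q⁺ (a∈T , a∈A))) ]′ (x∈p∪q⁻ S T a∈U))
    by-cases _ (no S─A=∅) _ (no T─A=∅) with x∈p─q⁻ U A b∈U─A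
    ... | b∈U , b∉A = ⊥-elim ([ (λ b∈S → S─A=∅ (b , x∈p∧x∉q⇒x∈p─q b∈S b∉A))
                               , (λ b∈T → T─A=∅ (b , x∈p∧x∉q⇒x∈p─q b∈T b∉A)) ]′ (x∈p∪q⁻ S T b∈U))

  -- Submodularity, posimodularity and the minimality of T leave S ∩ T and S ─ T at most one boundary
  -- edge each; an edge between them inside the connected set S then leaves none for S itself.
  uncross : ∀ {D w S T} → IsConnected S → S ⊆ D → ∂ S ≤ 2 → MinimalSmallCutAt D w T → w ∉ S → Adjacent S T →
            (∀ {A} → A ⊆ D → Nonempty A → 1 ≤ ∂ A) → ∂ (S ∪ T) ≤ 2
  uncross {D} {w} {S} {T} S-connected S⊆D S-small ((w∈T , T⊆D , T-small) , T-minimal) w∉S S~T positive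
    with ∂ (S ∪ T) ℕ.≤? 2
  ... | yes small = small
  ... | no  large = ⊥-elim (by-overlap (nonempty? (S ∩ T)))
    where
    both-small : ∂ S + ∂ T ≤ 4
    both-small = ℕ.+-mono-≤ S-small T-small
    by-overlap : Dec (Nonempty (S ∩ T)) → ⊥
    by-overlap (no S∩T=∅) =
      large (≤-cancel-summand (ℕ.≤-trans (∂-∪-adjacent S∩T=∅ S~T) both-small) ℕ.≤-refl)
    by-overlap (yes (x , x∈S∩T)) = by-remainder (nonempty? (S ─ T))
      where
      ∂S∩T≤1 : ∂ (S ∩ T) ≤ 1
      ∂S∩T≤1 = ≤-cancel-summand (ℕ.≤-trans (∂-submodular S T) both-small) (ℕ.≰⇒> large)
      T─S⊂T : T ─ S ⊂ T
      T─S⊂T = p∩q≢∅⇒p─q⊂p T S (x , x∈p∩q⁺ (Product.swap (x∈p∩q⁻ S T x∈S∩T)))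
      3≤∂T─S : 3 ≤ ∂ (T ─ S)
      3≤∂T─S = ℕ.≰⇒> λ small →
        T-minimal (T ─ S) T─S⊂T (x∈p∧x∉q⇒x∈p─q w∈T w∉S , T⊆D ∘ p─q⊆p T S , small)
      ∂S─T≤1 : ∂ (S ─ T) ≤ 1
      ∂S─T≤1 = ≤-cancel-summand (ℕ.≤-trans (∂-posimodular S T) both-small) 3≤∂T─S
      by-remainder : Dec (Nonempty (S ─ T)) → ⊥
      by-remainder (no S─T=∅) = large (subst (λ U → ∂ U ≤ 2) (sym S∪T≡T) T-small)
        where
        S∪T≡T : S ∪ T ≡ T
        S∪T≡T = ⊆-antisym (λ y∈S∪T → [ ─-empty⇒⊆ S─T=∅ , id ]′ (x∈p∪q⁻ S T y∈S∪T)) (q⊆p∪q S T)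
      by-remainder (yes S─T) =
        ℕ.<⇒≱ (positive S⊆D (x , proj₁ (x∈p∩q⁻ S T x∈S∩T)))
              (≤-cancel-summand (ℕ.≤-trans (∂-split-adjacent (S-connected T (x , x∈S∩T) S─T))
                                           (ℕ.+-mono-≤ ∂S∩T≤1 ∂S─T≤1))
                                ℕ.≤-refl)

  nonempty-subset-∂-pos : ∀ {D A} → IsConnected D → 1 ≤ ∂ D → A ⊆ D → Nonempty A → 1 ≤ ∂ A
  nonempty-subset-∂-pos {D} {A} D-connected ∂D-pos A⊆D (a , a∈A) with nonempty? (D ─ A)
  ... | no  D─A=∅ = subst (1 ≤_) (cong ∂ (⊆-antisym (─-empty⇒⊆ {P = D} {A} D─A=∅) A⊆D)) ∂D-pos
  ... | yes D─A with adjacent⇒joins (D-connected A (a , x∈p∩q⁺ (A⊆D a∈A , a∈A)) D─A)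
  ...   | _ , _ , _ , j , x∈D∩A , y∈D─A =
    exit⇒∂-pos j (proj₂ (x∈p∩q⁻ D A x∈D∩A)) (proj₂ (x∈p─q⁻ D A y∈D─A))

  SmallConnected : Subset n → Subset n → Set
  SmallConnected D S = IsConnected S × Nonempty S × S ⊆ D × ∂ S ≤ 2

  smallConnected? : ∀ D → Decidable (SmallConnected D)
  smallConnected? D S = connected? S ×-dec nonempty? S ×-dec S ⊆? D ×-dec ∂ S ℕ.≤? 2

  component-boundary : ∀ {K D} → IsCore G K → IsComponentMinus G K D → ∂ D ≤ 2
  component-boundary {K} {D} K-core D-comp@((c , c∈D) , _ , _ , _) with ∂ D ℕ.≤? 2
  ... | yes small = small
  ... | no  large = ⊥-elim (grow (⊂-maximal (smallConnected? D) (proj₂ seed)))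
    where
    D-connected : IsConnected D
    D-connected = component-connected D-comp

    minimal-cut-at : ∀ {w} → w ∈ D → ∃ (MinimalSmallCutAt D w)
    minimal-cut-at w∈D = ⊂-minimal (smallCutAt? D _) (proj₂ (small-cut-inside K-core D-comp w∈D))

    seed : ∃ (SmallConnected D)
    seed with minimal-cut-at c∈D
    ... | T , minimal@((c∈T , T⊆D , T-small) , _) =
      T , minimal-small-cut-connected minimal , (c , c∈T) , T⊆D , T-small

    grow : ∃[ S ] SmallConnected D S × (∀ U → S ⊂ U → ¬ SmallConnected D U) → ⊥
    grow (S , (S-connected , (s , s∈S) , S⊆D , S-small) , S-maximal) with nonempty? (D ─ S)
    ... | no D─S=∅ =
      large (subst (λ U → ∂ U ≤ 2) (⊆-antisym S⊆D (─-empty⇒⊆ {P = D} {S} D─S=∅)) S-small)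
    ... | yes D─S with adjacent⇒joins (D-connected S (s , x∈p∩q⁺ (S⊆D s∈S , s∈S)) D─S)
    ...   | _ , _ , w , j , x∈D∩S , w∈D─S with x∈p─q⁻ D S w∈D─S
    ...     | w∈D , w∉S with minimal-cut-at w∈D
    ...       | T , T-minimal@((w∈T , T⊆D , _) , _) =
      S-maximal (S ∪ T) (p⊆p∪q T , w , q⊆p∪q S T w∈T , w∉S)
        ( ∪-connected S-connected (minimal-small-cut-connected T-minimal) S~T
        , (s , p⊆p∪q T s∈S)
        , (λ y∈S∪T → [ S⊆D , T⊆D ]′ (x∈p∪q⁻ S T y∈S∪T))
        , uncross S-connected S⊆D S-small T-minimal w∉S S~T
                  (nonempty-subset-∂-pos D-connected (ℕ.≤-trans (s≤s z≤n) (ℕ.≰⇒> large))) )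
      where
      S~T : Adjacent S T
      S~T = joins⇒adjacent j (proj₂ (x∈p∩q⁻ D S x∈D∩S)) w∈T

  component-edges-to-core : ∀ {X C} → IsCore G X → IsComponentMinus G X C → edgesBetween G C X ≤ 2
  component-edges-to-core X-core C-comp@(_ , disjoint , _) =
    ℕ.≤-trans (edgesBetween≤∂ disjoint) (component-boundary X-core C-comp)

  coreOf-within : ∀ {K D z} → IsCore G K → IsComponentMinus G K D → z ∈ D → coreOf z ⊆ D
  coreOf-within {D = D} K-core D-comp z∈D {v} v∈K′ with v ∈? D
  ... | yes v∈D = v∈D
  ... | no  v∉D = ⊥-elim (ℕ.<⇒≱ (coreOf-elim v∈K′ D z∈D v∉D) (component-boundary K-core D-comp))

  components-disjoint : ∀ {K R D x z v} → IsComponentMinus G K R → IsComponentMinus G K D →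
                        x ∈ R → z ∈ D → z ∉ R → v ∈ R → v ∉ D
  components-disjoint {x = x} {z} {v} (_ , _ , R-connected , R-closed) (_ , _ , D-connected , D-closed)
                      x∈R z∈D z∉R v∈R v∈D =
    z∉R (R-closed x z x∈R (D-connected x z (D-closed v x v∈D (R-connected v x v∈R x∈R)) z∈D))

  coreOf-outside : ∀ {K R D x z v} → IsCore G K → IsComponentMinus G K R → IsComponentMinus G K D →
                   x ∈ R → z ∈ D → z ∉ R → v ∈ R → v ∉ coreOf z
  coreOf-outside K-core R-comp D-comp x∈R z∈D z∉R v∈R =
    components-disjoint R-comp D-comp x∈R z∈D z∉R v∈R ∘ coreOf-within K-core D-comp z∈D

  -- The first edge by which a walk from x to z leaves R ends in K, hence outside K′, so it enters R′.
  component-grows : Connected G → ∀ {K K′ R R′ x z} → IsComponentMinus G K R → IsComponentMinus G K′ R′ →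
                    x ∈ R → x ∈ R′ → z ∉ R → (∀ {v} → v ∈ R → v ∉ K′) → (∀ {v} → v ∈ K → v ∉ K′) →
                    R ⊂ R′
  component-grows connected {K} {K′} {R} {R′} {x} {z} R-comp@(_ , _ , R-connected , _) R′-comp@(_ , _ , _ , R′-closed)
                  x∈R x∈R′ z∉R R-avoids-K′ K-avoids-K′ with walk-exit R (connected x z) x∈R z∉R
  ... | record { outer = w ; joins = j ; inner∈A = u∈R ; outer∉A = w∉R } =
    R⊆R′ , w , component-step R′-comp (R⊆R′ u∈R) j w∉K′ , w∉R
    where
    R⊆R′ : R ⊆ R′
    R⊆R′ {v} v∈R with R-connected x v x∈R v∈R
    ... | p , p-avoids =
      R′-closed x v x∈R′ (p , λ y y∈p → R-avoids-K′ (component-walk R-comp x∈R p p-avoids y y∈p))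
    w∉K′ : w ∉ K′
    w∉K′ with w ∈? K
    ... | yes w∈K = K-avoids-K′ w∈K
    ... | no  w∉K = contradiction (component-step R-comp u∈R j w∉K) w∉R

  core-avoiding : (∃[ X ] ∃[ Y ] (IsCore G X × IsCore G Y × ¬ (X ≡ Y))) → ∀ x → ∃[ K ] IsCore G K × x ∉ K
  core-avoiding (X , Y , X-core , Y-core , X≢Y) x with x ∈? X | x ∈? Y
  ... | no  x∉X | _       = X , X-core , x∉X
  ... | yes _   | no  x∉Y = Y , Y-core , x∉Y
  ... | yes x∈X | yes x∈Y = ⊥-elim (X≢Y (trans (core-unique X-core x∈X) (sym (core-unique Y-core x∈Y))))

  module _ (connected : Connected G) (x : V G) where

    NonSeparatingCore : Set
    NonSeparatingCore = ∃[ X ] (IsCore G X × x ∉ X × ConnectedMinus G X)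

    shift-core : ∀ R → Acc _⊃_ R → ∀ {K} → IsCore G K → x ∉ K → x ∈ R → IsComponentMinus G K R →
                 NonSeparatingCore
    shift-core R (acc larger) {K} K-core x∉K x∈R R-comp@(_ , _ , R-connected , _)
      with any? (λ z → ¬? (z ∈? K) ×-dec ¬? (z ∈? R))
    ... | no  none = K , K-core , x∉K , λ u v u∉K v∉K → R-connected u v (in-R u∉K) (in-R v∉K)
      where
      in-R : ∀ {v} → v ∉ K → v ∈ R
      in-R {v} v∉K with v ∈? R
      ... | yes v∈R = v∈R
      ... | no  v∉R = contradiction (v , v∉K , v∉R) none
    ... | yes (z , z∉K , z∉R) with component K z∉K
    ...   | D , z∈D , D-comp@(_ , D-disjoint , _)
      with component (coreOf z) (coreOf-outside K-core R-comp D-comp x∈R z∈D z∉R x∈R)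
    ...     | R′ , x∈R′ , R′-comp =
      shift-core R′ (larger (component-grows connected R-comp R′-comp x∈R x∈R′ z∉R R-avoids-K′ K-avoids-K′))
                 (coreOf-core z) (R-avoids-K′ x∈R) x∈R′ R′-comp
      where
      R-avoids-K′ : ∀ {v} → v ∈ R → v ∉ coreOf z
      R-avoids-K′ = coreOf-outside K-core R-comp D-comp x∈R z∈D z∉R
      K-avoids-K′ : ∀ {v} → v ∈ K → v ∉ coreOf z
      K-avoids-K′ v∈K v∈K′ = D-disjoint _ (coreOf-within K-core D-comp z∈D v∈K′) v∈K

    nonseparating-core : (∃[ X ] ∃[ Y ] (IsCore G X × IsCore G Y × ¬ (X ≡ Y))) → NonSeparatingCore
    nonseparating-core two-cores with core-avoiding two-cores x
    ... | K , K-core , x∉K with component K x∉K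
    ...   | R , x∈R , R-comp = shift-core R (⊃-wellFounded R) K-core x∉K x∈R R-comp

lemma4p1 : (G : Graph) →
    (∀ X C → IsCore G X → IsComponentMinus G X C → edgesBetween G C X ≤ 2) ×
    (Connected G →
      (∃[ X ] ∃[ Y ] (IsCore G X × IsCore G Y × ¬ (X ≡ Y))) →
      ∀ x → ∃[ X ] (IsCore G X × x ∉ X × ConnectedMinus G X))
lemma4p1 G =
  (λ X C → component-edges-to-core G) , λ connected two-cores x → nonseparating-core G connected x two-cores
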